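{- Let $n\ge 3$ and $\pi_1,\pi_2\in S_n$. If $G^-_{\pi_1}\approx G^-_{\pi_2}$, then $G_{\pi_1}\approx G_{\pi_2}$.
   Context: $S_n$ is the symmetric group on $\{1,\dots,n\}$. Fix disjoint vertex sets $A=\{a_1,\dots,a_n\}$, $B=\{b_1,\dots,b_n\}$, $C=\{c_1,\dots,c_n\}$, $D=\{d_1,\dots,d_n\}$. For $\pi\in S_n$, $G^-_\pi$ is the graph on $A\cup B\cup C\cup D$ with edges $\{a_i,b_j\}$ ($i\ne j$), $\{b_i,c_i\}$ (all $i$), $\{c_i,d_j\}$ ($i\ne j$), and $\{a_i,d_{\pi(i)}\}$ (all $i$). $G_\pi$ is obtained from $G^-_\pi$ by adding three new vertices $e,f,g$ with neighbourhoods $N(e)=B\cup D\cup\{f,g\}$, $N(f)=A\cup C\cup\{e\}$, $N(g)=C\cup\{e\}$. For a vertex set $S$, $N(S)$ is the set of vertices adjacent to some vertex of $S$. Two connected bipartite graphs $G,H$ are neighbourhood size equivalent, $G\approx H$, if there are bipartitions $(X^G,Y^G)$ of $G$ and $(X^H,Y^H)$ of $H$ with $|X^G|\le|Y^G|$, $|X^H|\le|Y^H|$, $|X^G|=|X^H|$, $|Y^G|=|Y^H|$, and a bijection $\eta$ from the power set of $X^G$ to the power set of $X^H$ such that for every $S\subseteq X^G$: $|\eta(S)|=|S|$ and $|N(\eta(S))| = |N(S)|$. -}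

module Defs where

open import Data.Bool using (Bool; true; false; _∧_; _∨_; not)
open import Data.Nat using (ℕ; zero; suc; _+_; _*_; _≤_)
open import Data.Fin using (Fin; zero; suc; splitAt; remQuot; _≟_)
open import Data.Fin.Subset using (Subset; _∈_; _∉_; _⊆_; ∁; ∣_∣)
open import Data.Fin.Permutation using (Permutation′; _⟨$⟩ʳ_)
open import Data.Vec using (tabulate; lookup)
open import Data.Product using (Σ; _×_; _,_; ∃)
open import Data.Sum using (_⊎_; inj₁; inj₂)
open import Relation.Nullary.Decidable using (⌊_⌋)
open import Relation.Binary.PropositionalEquality using (_≡_)

record Graph : Set where
  field
    N   : ℕ
    adj : Fin N → Fin N → Bool
open Graph public

anyᶠ : ∀ {N} → (Fin N → Bool) → Bool
anyᶠ {zero}  f = false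
anyᶠ {suc N} f = f zero ∨ anyᶠ (λ i → f (suc i))

Nbhd : (G : Graph) → Subset (N G) → Subset (N G)
Nbhd G S = tabulate (λ v → anyᶠ (λ u → lookup S u ∧ adj G u v))

data Reach (G : Graph) : Fin (N G) → Fin (N G) → Set where
  here : ∀ {u} → Reach G u u
  step : ∀ {u w v} → adj G u w ≡ true → Reach G w v → Reach G u v

Connected : Graph → Set
Connected G = ∀ u v → Reach G u v

IsBipartition : (G : Graph) → Subset (N G) → Set
IsBipartition G X = ∀ u v → adj G u v ≡ true →
  (u ∈ X → v ∉ X) × (u ∉ X → v ∈ X)

-- Bipartitions are (X^G , ∁ X^G) and (X^H , ∁ X^H); η is a bijection from
-- the power set of X^G onto the power set of X^H (represented as a map on
-- all subsets, required to send subsets of X^G to subsets of X^H and to be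
-- injective and surjective between these power sets).
_≈_ : Graph → Graph → Set
G ≈ H =
  Connected G × Connected H ×
  Σ (Subset (N G)) λ XG → Σ (Subset (N H)) λ XH →
    IsBipartition G XG × IsBipartition H XH ×
    ∣ XG ∣ ≤ ∣ ∁ XG ∣ × ∣ XH ∣ ≤ ∣ ∁ XH ∣ ×
    ∣ XG ∣ ≡ ∣ XH ∣ × ∣ ∁ XG ∣ ≡ ∣ ∁ XH ∣ ×
    Σ (Subset (N G) → Subset (N H)) λ η →
      (∀ S → S ⊆ XG → η S ⊆ XH) ×
      (∀ S S′ → S ⊆ XG → S′ ⊆ XG → η S ≡ η S′ → S ≡ S′) ×
      (∀ T → T ⊆ XH → ∃ λ S → S ⊆ XG × η S ≡ T) ×
      (∀ S → S ⊆ XG → ∣ η S ∣ ≡ ∣ S ∣ × ∣ Nbhd H (η S) ∣ ≡ ∣ Nbhd G S ∣)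

data V⁻ (n : ℕ) : Set where
  a b c d : Fin n → V⁻ n

data V (n : ℕ) : Set where
  old : V⁻ n → V n
  e f g : V n

_==_ : ∀ {n} → Fin n → Fin n → Bool
i == j = ⌊ i ≟ j ⌋

adj⁻ : ∀ {n} → Permutation′ n → V⁻ n → V⁻ n → Bool
adj⁻ π (a i) (b j) = not (i == j)
adj⁻ π (b i) (a j) = not (i == j)
adj⁻ π (b i) (c j) = i == j
adj⁻ π (c i) (b j) = i == j
adj⁻ π (c i) (d j) = not (i == j)
adj⁻ π (d i) (c j) = not (i == j)
adj⁻ π (a i) (d j) = (π ⟨$⟩ʳ i) == j
adj⁻ π (d i) (a j) = (π ⟨$⟩ʳ j) == i
adj⁻ π _     _     = false

adjV : ∀ {n} → Permutation′ n → V n → V n → Bool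
adjV π (old x) (old y) = adj⁻ π x y
adjV π e (old (b _)) = true
adjV π e (old (d _)) = true
adjV π (old (b _)) e = true
adjV π (old (d _)) e = true
adjV π f (old (a _)) = true
adjV π f (old (c _)) = true
adjV π (old (a _)) f = true
adjV π (old (c _)) f = true
adjV π g (old (c _)) = true
adjV π (old (c _)) g = true
adjV π e f = true
adjV π f e = true
adjV π e g = true
adjV π g e = true
adjV π _ _ = false

decode⁻ : ∀ n → Fin (4 * n) → V⁻ n
decode⁻ n k with remQuot {4} n k
... | zero , i = a i
... | suc zero , i = b i
... | suc (suc zero) , i = c i
... | suc (suc (suc zero)) , i = d i

decode : ∀ n → Fin (4 * n + 3) → V n
decode n k with splitAt (4 * n) k
... | inj₁ x = old (decode⁻ n x)
... | inj₂ zero = e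
... | inj₂ (suc zero) = f
... | inj₂ (suc (suc zero)) = g

G⁻ : ∀ {n} → Permutation′ n → Graph
G⁻ {n} π = record { N = 4 * n ; adj = λ u v → adj⁻ π (decode⁻ n u) (decode⁻ n v) }

Gπ : ∀ {n} → Permutation′ n → Graph
Gπ {n} π = record { N = 4 * n + 3 ; adj = λ u v → adjV π (decode n u) (decode n v) }

{-# OPTIONS --safe #-}
-- For n ≥ 3 the only bipartition of G⁻_π is {A ∪ C, B ∪ D}. On either side, the 2-sets S
-- with |N(S)| = 2n, i.e. dominating the other side, are exactly the sets {a_i, c_i}, resp.
-- {b_i, d_i}, with π(i) = i. A neighbourhood size equivalence between G⁻_π₁ and G⁻_π₂
-- preserves these sets, so π₁ and π₂ have equally many fixed points, and some permutation β
-- maps the fixed points of π₁ onto those of π₂.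
--
-- In G_π take X = A ∪ C ∪ {e} and write S ⊆ X as I ∪ J ∪ E with I ⊆ A, J ⊆ C, E ⊆ {e}.
-- If |I| ≠ 1, whether b_m has a neighbour in I does not depend on m, so replacing I by
-- π₂⁻¹π₁(I) leaves N(S) unchanged. If I = {a_i}, replace I by {a_(β i)} and J by τ_i(J), where
-- τ_i is a permutation with τ_i(i) = β(i) and τ_i(π₁ i) = π₂(β i); it exists because i is
-- fixed by π₁ iff β(i) is fixed by π₂, and relabelling B and D by τ_i carries N(S) onto the
-- new neighbourhood. In both cases f and g only see which of I, J, E are empty.
module Submission where

open import Defs
open import Data.Nat using (ℕ; _≤_)
open import Data.Fin.Permutation using (Permutation′)

import Algebra.Properties.CommutativeMonoid.Sum as Sum
open import Data.Bool using (Bool; true; false; not; _∧_; _∨_)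
open import Data.Bool.Properties
  using (∨-assoc; not-involutive; ⇔→≡; ∧-comm; T-≡; ∧-identityʳ; ∧-inverseʳ; ∨-identityʳ; ∨-zeroʳ; ∧-zeroʳ; ∨-inverseˡ; ∨-inverseʳ)
open import Data.Fin using (Fin; zero; suc; _≟_; fromℕ<; _↑ˡ_; _↑ʳ_; combine; remQuot; splitAt; join)
import Data.Fin.Properties as Fin
open import Data.Fin.Permutation using (_⟨$⟩ʳ_; _⟨$⟩ˡ_; inverseˡ; inverseʳ; flip; id; _∘ₚ_; lift₀; transpose)
open import Data.Fin.Subset using (Subset; _⊆_; _∈_; _∉_; ∁; ∣_∣) renaming (⊥ to ∅)
open import Data.Fin.Subset.Properties using (_⊆?_)
open import Data.Nat using (zero; suc; _+_; _*_; _<_; s≤s; z≤n)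
import Data.Nat.Properties as ℕ
open import Data.Nat.Properties
  using (+-assoc; +-identityʳ; +-monoʳ-≤; ≤-trans; ≤-antisym; ≤-pred; +-suc; m≤n+m; +-0-commutativeMonoid; +-cancelˡ-≡;
         <⇒≢; +-mono-<-≤; +-mono-≤-<; m≤n⇒m≤1+n; suc-injective)
open import Data.Product using (Σ; ∃; _×_; _,_; proj₁; proj₂; uncurry)
open import Data.Sum using (inj₁; inj₂)
open import Data.Vec using ([]; _∷_; lookup; tabulate)
import Data.Vec.Properties as Vec
open import Function using (_∘_; Equivalence; mk⇔)
open import Relation.Binary.PropositionalEquality
  using (_≡_; _≢_; _≗_; refl; sym; trans; cong; cong₂; subst; subst₂; module ≡-Reasoning)
open import Relation.Nullary using (Dec; yes; no; contradiction)
open import Relation.Nullary.Decidable using (dec-true; dec-false; isYes≗does; toWitness)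

private
  variable
    n : ℕ

≡⇒== : {i j : Fin n} → i ≡ j → (i == j) ≡ true
≡⇒== {i = i} {j} i≡j = trans (isYes≗does (i ≟ j)) (dec-true (i ≟ j) i≡j)

≢⇒==-false : {i j : Fin n} → i ≢ j → (i == j) ≡ false
≢⇒==-false {i = i} {j} i≢j = trans (isYes≗does (i ≟ j)) (dec-false (i ≟ j) i≢j)

==-refl : (i : Fin n) → (i == i) ≡ true
==-refl i = ≡⇒== refl

==⇒≡ : {i j : Fin n} → (i == j) ≡ true → i ≡ j
==⇒≡ p = toWitness (Equivalence.from T-≡ p)

==-sym : (i j : Fin n) → (i == j) ≡ (j == i)
==-sym i j = ⇔→≡ (mk⇔ (≡⇒== ∘ sym ∘ ==⇒≡) (≡⇒== ∘ sym ∘ ==⇒≡))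

⟨$⟩ʳ-injective : (σ : Permutation′ n) {i j : Fin n} → σ ⟨$⟩ʳ i ≡ σ ⟨$⟩ʳ j → i ≡ j
⟨$⟩ʳ-injective σ {i} {j} eq = trans (sym (inverseˡ σ)) (trans (cong (σ ⟨$⟩ˡ_) eq) (inverseˡ σ))

==-⟨$⟩ʳ : (σ : Permutation′ n) (i j : Fin n) → ((σ ⟨$⟩ʳ i) == (σ ⟨$⟩ʳ j)) ≡ (i == j)
==-⟨$⟩ʳ σ i j = ⇔→≡ (mk⇔ (≡⇒== ∘ ⟨$⟩ʳ-injective σ ∘ ==⇒≡) (≡⇒== ∘ cong (σ ⟨$⟩ʳ_) ∘ ==⇒≡))

⟨$⟩ˡ-== : (σ : Permutation′ n) (i j : Fin n) → ((σ ⟨$⟩ˡ i) == j) ≡ (i == (σ ⟨$⟩ʳ j))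
⟨$⟩ˡ-== σ i j = trans (sym (==-⟨$⟩ʳ σ (σ ⟨$⟩ˡ i) j)) (cong (_== (σ ⟨$⟩ʳ j)) (inverseʳ σ))

⟨$⟩ʳ-== : (σ : Permutation′ n) (i j : Fin n) → ((σ ⟨$⟩ʳ i) == j) ≡ (i == (σ ⟨$⟩ˡ j))
⟨$⟩ʳ-== σ i j = trans (cong ((σ ⟨$⟩ʳ i) ==_) (sym (inverseʳ σ))) (==-⟨$⟩ʳ σ i (σ ⟨$⟩ˡ j))

suc-== : (i j : Fin n) → (suc i == suc j) ≡ (i == j)
suc-== i j = ⇔→≡ (mk⇔ (≡⇒== ∘ Fin.suc-injective ∘ ==⇒≡) (≡⇒== ∘ cong suc ∘ ==⇒≡))

∧-≡-true : ∀ {x y} → (x ∧ y) ≡ true → x ≡ true × y ≡ true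
∧-≡-true {true} y≡true = refl , y≡true

fresh : 3 ≤ n → (i j : Fin n) → ∃ λ m → m ≢ i × m ≢ j
fresh {suc zero}       (s≤s ())       i j
fresh {suc (suc zero)} (s≤s (s≤s ())) i j
fresh {suc (suc (suc _))} _ i j with zero ≟ i | zero ≟ j
... | no 0≢i   | no 0≢j = zero , 0≢i , 0≢j
... | yes refl | _ with suc zero ≟ j
...   | no 1≢j   = suc zero , (λ ()) , 1≢j
...   | yes refl = suc (suc zero) , (λ ()) , (λ ())
fresh {suc (suc (suc _))} _ i j | no 0≢i | yes refl with suc zero ≟ i
...   | no 1≢i   = suc zero , 1≢i , (λ ())
...   | yes refl = suc (suc zero) , (λ ()) , (λ ())

-- Existence and counting over Fin

anyᶠ-intro : (P : Fin n → Bool) (i : Fin n) → P i ≡ true → anyᶠ P ≡ true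
anyᶠ-intro P zero    Pi rewrite Pi = refl
anyᶠ-intro P (suc i) Pi with P zero
... | true  = refl
... | false = anyᶠ-intro (P ∘ suc) i Pi

anyᶠ⇒∃ : (P : Fin n → Bool) → anyᶠ P ≡ true → ∃ λ i → P i ≡ true
anyᶠ⇒∃ {suc n} P any with P zero in P0
... | true  = zero , P0
... | false = let i , Pi = anyᶠ⇒∃ (P ∘ suc) any in suc i , Pi

anyᶠ-none : (P : Fin n → Bool) → (∀ i → P i ≡ false) → anyᶠ P ≡ false
anyᶠ-none {zero}  P none = refl
anyᶠ-none {suc n} P none rewrite none zero = anyᶠ-none (P ∘ suc) (none ∘ suc)

anyᶠ-cong : {P Q : Fin n → Bool} → P ≗ Q → anyᶠ P ≡ anyᶠ Q
anyᶠ-cong {zero}  P≗Q = refl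
anyᶠ-cong {suc n} P≗Q = cong₂ _∨_ (P≗Q zero) (anyᶠ-cong (P≗Q ∘ suc))

anyᶠ-permute : (P : Fin n → Bool) (σ : Permutation′ n) → anyᶠ (P ∘ (σ ⟨$⟩ʳ_)) ≡ anyᶠ P
anyᶠ-permute P σ = ⇔→≡ (mk⇔
  (λ any → let i , Pσi = anyᶠ⇒∃ (P ∘ (σ ⟨$⟩ʳ_)) any in anyᶠ-intro P (σ ⟨$⟩ʳ i) Pσi)
  (λ any → let i , Pi = anyᶠ⇒∃ P any in
           anyᶠ-intro (P ∘ (σ ⟨$⟩ʳ_)) (σ ⟨$⟩ˡ i) (trans (cong P (inverseʳ σ)) Pi)))

anyᶠ-∧-singleton : {P : Fin n → Bool} {i : Fin n} → P ≗ (_== i) →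
                   (h : Fin n → Bool) → anyᶠ (λ m → P m ∧ h m) ≡ h i
anyᶠ-∧-singleton {P = P} {i} P≗i h = ⇔→≡ (mk⇔
  (λ any → let m , Pm∧hm = anyᶠ⇒∃ (λ m → P m ∧ h m) any
               Pm , hm = ∧-≡-true Pm∧hm
           in subst (λ k → h k ≡ true) (==⇒≡ (trans (sym (P≗i m)) Pm)) hm)
  (λ hi → anyᶠ-intro (λ m → P m ∧ h m) i (cong₂ _∧_ (trans (P≗i i) (==-refl i)) hi)))

anyᶠ-∧-== : (h : Fin n → Bool) (i : Fin n) → anyᶠ (λ m → h m ∧ (m == i)) ≡ h i
anyᶠ-∧-== h i = trans (anyᶠ-cong (λ m → ∧-comm (h m) (m == i))) (anyᶠ-∧-singleton (λ _ → refl) h)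

anyᶠ-∧-false : (P : Fin n → Bool) → anyᶠ (λ m → P m ∧ false) ≡ false
anyᶠ-∧-false P = anyᶠ-none _ (∧-zeroʳ ∘ P)

anyᶠ-false : anyᶠ {n} (λ _ → false) ≡ false
anyᶠ-false {n} = anyᶠ-none {n} _ (λ _ → refl)

anyᶠ-∧-true : (P : Fin n → Bool) → anyᶠ (λ m → P m ∧ true) ≡ anyᶠ P
anyᶠ-∧-true P = anyᶠ-cong (∧-identityʳ ∘ P)

_─_ : (Fin n → Bool) → Fin n → Fin n → Bool
(P ─ j) m = P m ∧ not (m == j)

𝟙 : Bool → ℕ
𝟙 true  = 1
𝟙 false = 0

open Sum +-0-commutativeMonoid using (sum; sum-permute; sum-cong-≗)

count : (Fin n → Bool) → ℕ
count P = sum (𝟙 ∘ P)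

count-cong : {P Q : Fin n → Bool} → P ≗ Q → count P ≡ count Q
count-cong P≗Q = sum-cong-≗ (cong 𝟙 ∘ P≗Q)

count-permute : (P : Fin n → Bool) (σ : Permutation′ n) → count (P ∘ (σ ⟨$⟩ʳ_)) ≡ count P
count-permute P σ = sym (sum-permute (𝟙 ∘ P) σ)

count≤n : (P : Fin n → Bool) → count P ≤ n
count≤n {zero}  P = z≤n
count≤n {suc n} P with P zero
... | true  = s≤s (count≤n (P ∘ suc))
... | false = m≤n⇒m≤1+n (count≤n (P ∘ suc))

count<n : (P : Fin n → Bool) (k : Fin n) → P k ≡ false → count P < n
count<n P zero    Pk rewrite Pk = s≤s (count≤n (P ∘ suc))
count<n P (suc k) Pk with P zero
... | true  = s≤s (count<n (P ∘ suc) k Pk)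
... | false = m≤n⇒m≤1+n (count<n (P ∘ suc) k Pk)

count-all : (P : Fin n → Bool) → (∀ i → P i ≡ true) → count P ≡ n
count-all {zero}  P all = refl
count-all {suc n} P all rewrite all zero = cong suc (count-all (P ∘ suc) (all ∘ suc))

count-none : (P : Fin n → Bool) → (∀ i → P i ≡ false) → count P ≡ 0
count-none {zero}  P none = refl
count-none {suc n} P none rewrite none zero = count-none (P ∘ suc) (none ∘ suc)

count-false : count {n} (λ _ → false) ≡ 0
count-false {n} = count-none {n} _ (λ _ → refl)

count-true : count {n} (λ _ → true) ≡ n
count-true = count-all _ (λ _ → refl)

count>0 : (P : Fin n → Bool) (i : Fin n) → P i ≡ true → 0 < count P
count>0 P zero    Pi rewrite Pi = s≤s z≤n
count>0 P (suc i) Pi = ≤-trans (count>0 (P ∘ suc) i Pi) (m≤n+m _ (𝟙 (P zero)))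

count≡0⇒none : (P : Fin n → Bool) → count P ≡ 0 → ∀ i → P i ≡ false
count≡0⇒none P c≡0 i with P i in Pi
... | false = refl
... | true  = contradiction (sym c≡0) (<⇒≢ (count>0 P i Pi))

count>0⇒∃ : (P : Fin n → Bool) → 0 < count P → ∃ λ i → P i ≡ true
count>0⇒∃ {suc n} P pos with P zero in P0
... | true  = zero , P0
... | false = let i , Pi = count>0⇒∃ (P ∘ suc) pos in suc i , Pi

count-─ : (P : Fin n → Bool) (j : Fin n) → P j ≡ true → count P ≡ suc (count (P ─ j))
count-─ P zero Pj rewrite Pj = cong suc (count-cong (λ m → sym (∧-identityʳ (P (suc m)))))
count-─ P (suc j) Pj = begin
  𝟙 (P zero) + count (P ∘ suc)              ≡⟨ cong (𝟙 (P zero) +_) (count-─ (P ∘ suc) j Pj) ⟩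
  𝟙 (P zero) + suc (count ((P ∘ suc) ─ j))  ≡⟨ +-suc (𝟙 (P zero)) _ ⟩
  suc (𝟙 (P zero) + count ((P ∘ suc) ─ j))  ≡⟨ cong suc (cong₂ _+_ (cong 𝟙 (sym (∧-identityʳ (P zero))))
                                                 (count-cong (λ m → cong (λ b → P (suc m) ∧ not b) (sym (suc-== m j))))) ⟩
  suc (count (P ─ suc j))                   ∎
  where open ≡-Reasoning

count-singleton : (i : Fin n) → count (_== i) ≡ 1
count-singleton i = trans (count-─ (_== i) i (==-refl i))
  (cong suc (count-none ((_== i) ─ i) (λ m → ∧-inverseʳ (m == i))))

count≡1⇒singleton : (P : Fin n → Bool) → count P ≡ 1 → ∃ λ i → P ≗ (_== i)
count≡1⇒singleton P c≡1 = i , P≗i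
  where
  witness : ∃ λ i → P i ≡ true
  witness = count>0⇒∃ P (subst (0 <_) (sym c≡1) (s≤s z≤n))
  i = proj₁ witness
  P≗i : P ≗ (_== i)
  P≗i m with m ≟ i
  ... | yes refl = proj₂ witness
  ... | no m≢i   = begin
    P m                     ≡⟨ sym (∧-identityʳ (P m)) ⟩
    P m ∧ not false         ≡⟨ cong (λ b → P m ∧ not b) (sym (≢⇒==-false m≢i)) ⟩
    (P ─ i) m               ≡⟨ count≡0⇒none (P ─ i) (suc-injective (trans (sym (count-─ P i (proj₂ witness))) c≡1)) m ⟩
    false                   ∎
    where open ≡-Reasoning

anyᶠ-─-singleton : {P : Fin n → Bool} {i : Fin n} → P ≗ (_== i) → (m : Fin n) → anyᶠ (P ─ m) ≡ not (i == m)
anyᶠ-─-singleton P≗i m = anyᶠ-∧-singleton P≗i (λ k → not (k == m))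

anyᶠ-─-count≡0 : (P : Fin n → Bool) → count P ≡ 0 → (m : Fin n) → anyᶠ (P ─ m) ≡ false
anyᶠ-─-count≡0 P c≡0 m = anyᶠ-none (P ─ m) (λ i → cong (_∧ _) (count≡0⇒none P c≡0 i))

anyᶠ-─-count≥2 : (P : Fin n → Bool) → 2 ≤ count P → (m : Fin n) → anyᶠ (P ─ m) ≡ true
anyᶠ-─-count≥2 P 2≤c m with P m in Pm
... | true  = let i , Pi = count>0⇒∃ (P ─ m) (≤-pred (subst (2 ≤_) (count-─ P m Pm) 2≤c))
              in anyᶠ-intro (P ─ m) i Pi
... | false = let i , Pi = count>0⇒∃ P (≤-trans (s≤s z≤n) 2≤c)
                  i≢m : i ≢ m
                  i≢m i≡m = contradiction (trans (sym Pi) (trans (cong P i≡m) Pm)) λ ()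
              in anyᶠ-intro (P ─ m) i (cong₂ _∧_ Pi (cong not (≢⇒==-false i≢m)))

anyᶠ-─-count≢1 : (P Q : Fin n → Bool) → count P ≢ 1 → count Q ≡ count P →
                 (m : Fin n) → anyᶠ (Q ─ m) ≡ anyᶠ (P ─ m)
anyᶠ-─-count≢1 P Q c≢1 cQ≡cP m with count P in cP
... | 0           = trans (anyᶠ-─-count≡0 Q cQ≡cP m) (sym (anyᶠ-─-count≡0 P cP m))
... | 1           = contradiction refl c≢1
... | suc (suc k) = trans (anyᶠ-─-count≥2 Q (subst (2 ≤_) (sym cQ≡cP) (s≤s (s≤s z≤n))) m)
                          (sym (anyᶠ-─-count≥2 P (subst (2 ≤_) (sym cP) (s≤s (s≤s z≤n))) m))

injection⇒count≤ : ∀ {m} (P : Fin n → Bool) (Q : Fin m → Bool)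
  (h : (i : Fin n) → P i ≡ true → Fin m) →
  (∀ i Pi → Q (h i Pi) ≡ true) →
  (∀ i i′ Pi Pi′ → h i Pi ≡ h i′ Pi′ → i ≡ i′) →
  count P ≤ count Q
injection⇒count≤ {zero}  P Q h h∈Q h-inj = z≤n
injection⇒count≤ {suc n} P Q h h∈Q h-inj with P zero in P0
... | false = injection⇒count≤ (P ∘ suc) Q (h ∘ suc) (h∈Q ∘ suc)
                (λ i i′ Pi Pi′ eq → Fin.suc-injective (h-inj (suc i) (suc i′) Pi Pi′ eq))
... | true  = subst (suc (count (P ∘ suc)) ≤_) (sym (count-─ Q h₀ (h∈Q zero P0)))
                (s≤s (injection⇒count≤ (P ∘ suc) (Q ─ h₀) (h ∘ suc) h∈Q─h₀
                       (λ i i′ Pi Pi′ eq → Fin.suc-injective (h-inj (suc i) (suc i′) Pi Pi′ eq))))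
  where
  h₀ = h zero P0
  h∈Q─h₀ : ∀ i Pi → (Q ─ h₀) (h (suc i) Pi) ≡ true
  h∈Q─h₀ i Pi = cong₂ _∧_ (h∈Q (suc i) Pi)
    (cong not (≢⇒==-false (λ eq → Fin.0≢1+n (sym (h-inj (suc i) zero Pi P0 eq)))))

count<n⇒∃false : (P : Fin n → Bool) → count P < n → ∃ λ k → P k ≡ false
count<n⇒∃false {suc n} P c<n with P zero in P0
... | false = zero , P0
... | true  = let k , Pk = count<n⇒∃false (P ∘ suc) (≤-pred c<n) in suc k , Pk

count≡⇒permutation : (P Q : Fin n → Bool) → count P ≡ count Q →
                     Σ (Permutation′ n) λ σ → Q ∘ (σ ⟨$⟩ʳ_) ≗ P
count≡⇒permutation {zero}  P Q eq = id , λ ()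
count≡⇒permutation {suc n} P Q eq = lift₀ σ ∘ₚ t , Qσ≗P
  where
  witness : ∃ λ k → Q k ≡ P zero
  witness with P zero
  ... | true  = count>0⇒∃ Q (subst (0 <_) eq (s≤s z≤n))
  ... | false = count<n⇒∃false Q (subst (_< suc n) eq (s≤s (count≤n (P ∘ suc))))
  t = transpose zero (proj₁ witness)
  Qt0≡P0 : Q (t ⟨$⟩ʳ zero) ≡ P zero
  Qt0≡P0 = proj₂ witness
  tails : count (P ∘ suc) ≡ count (Q ∘ (t ⟨$⟩ʳ_) ∘ suc)
  tails = +-cancelˡ-≡ (𝟙 (P zero)) _ _ (begin
    𝟙 (P zero) + count (P ∘ suc)                          ≡⟨ eq ⟩
    count Q                                                ≡⟨ count-permute Q t ⟨
    𝟙 (Q (t ⟨$⟩ʳ zero)) + count (Q ∘ (t ⟨$⟩ʳ_) ∘ suc)     ≡⟨ cong (λ b → 𝟙 b + count (Q ∘ (t ⟨$⟩ʳ_) ∘ suc)) Qt0≡P0 ⟩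
    𝟙 (P zero) + count (Q ∘ (t ⟨$⟩ʳ_) ∘ suc)              ∎)
    where open ≡-Reasoning
  σ = proj₁ (count≡⇒permutation (P ∘ suc) (Q ∘ (t ⟨$⟩ʳ_) ∘ suc) tails)
  Qσ≗P : Q ∘ ((lift₀ σ ∘ₚ t) ⟨$⟩ʳ_) ≗ P
  Qσ≗P zero    = Qt0≡P0
  Qσ≗P (suc i) = proj₂ (count≡⇒permutation (P ∘ suc) (Q ∘ (t ⟨$⟩ʳ_) ∘ suc) tails) i

count-∨ʳ : {P Q : Fin n → Bool} → count P ≡ count Q → (b : Bool) →
           count (λ m → P m ∨ b) ≡ count (λ m → Q m ∨ b)
count-∨ʳ {P = P} {Q} eq false = trans (count-cong (∨-identityʳ ∘ P)) (trans eq (sym (count-cong (∨-identityʳ ∘ Q))))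
count-∨ʳ {P = P} {Q} eq true  = trans (count-cong (∨-zeroʳ ∘ P)) (sym (count-cong (∨-zeroʳ ∘ Q)))

count+count≡n+n⇒all : (P Q : Fin n → Bool) → count P + count Q ≡ n + n →
                      (∀ m → P m ≡ true) × (∀ m → Q m ≡ true)
count+count≡n+n⇒all {n} P Q eq = all P (λ m Pm → +-mono-<-≤ (count<n P m Pm) (count≤n Q))
                               , all Q (λ m Qm → +-mono-≤-< (count≤n P) (count<n Q m Qm))
  where
  all : (R : Fin n → Bool) → (∀ m → R m ≡ false → count P + count Q < n + n) → ∀ m → R m ≡ true
  all R short m with R m in Rm
  ... | true  = refl
  ... | false = contradiction eq (<⇒≢ (short m Rm))

anyᶠ-+ : ∀ m {k} (F : Fin (m + k) → Bool) → anyᶠ F ≡ anyᶠ (F ∘ (_↑ˡ k)) ∨ anyᶠ (F ∘ (m ↑ʳ_))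
anyᶠ-+ zero    F = refl
anyᶠ-+ (suc m) F = trans (cong (F zero ∨_) (anyᶠ-+ m (F ∘ suc))) (sym (∨-assoc (F zero) _ _))

count-+ : ∀ m {k} (F : Fin (m + k) → Bool) → count F ≡ count (F ∘ (_↑ˡ k)) + count (F ∘ (m ↑ʳ_))
count-+ zero    F = refl
count-+ (suc m) F = trans (cong (𝟙 (F zero) +_) (count-+ m (F ∘ suc))) (sym (+-assoc (𝟙 (F zero)) _ _))

anyᶠ-* : ∀ m {k} (F : Fin (m * k) → Bool) → anyᶠ F ≡ anyᶠ {m} (λ q → anyᶠ (λ j → F (combine q j)))
anyᶠ-* zero    F = refl
anyᶠ-* (suc m) {k} F = trans (anyᶠ-+ k F) (cong (anyᶠ (F ∘ (_↑ˡ (m * k))) ∨_) (anyᶠ-* m (F ∘ (k ↑ʳ_))))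

count-* : ∀ m {k} (F : Fin (m * k) → Bool) → count F ≡ sum {m} (λ q → count (λ j → F (combine q j)))
count-* zero    F = refl
count-* (suc m) {k} F = trans (count-+ k F) (cong (count (F ∘ (_↑ˡ (m * k))) +_) (count-* m (F ∘ (k ↑ʳ_))))

transpose-⟨$⟩ʳ-left : (i j : Fin n) → transpose i j ⟨$⟩ʳ i ≡ j
transpose-⟨$⟩ʳ-left i j rewrite dec-true (i ≟ i) refl = refl

transpose-⟨$⟩ʳ-other : (i j k : Fin n) → k ≢ i → k ≢ j → transpose i j ⟨$⟩ʳ k ≡ k
transpose-⟨$⟩ʳ-other i j k k≢i k≢j rewrite dec-false (k ≟ i) k≢i | dec-false (k ≟ j) k≢j = refl

-- ∘ₚ composes diagrammatically: first p ↦ p′, then the image of q ↦ q′.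
twoPointPermutation : (p p′ q q′ : Fin n) → Permutation′ n
twoPointPermutation p p′ q q′ = transpose p p′ ∘ₚ transpose (transpose p p′ ⟨$⟩ʳ q) q′

twoPointPermutation-q : (p p′ q q′ : Fin n) → twoPointPermutation p p′ q q′ ⟨$⟩ʳ q ≡ q′
twoPointPermutation-q p p′ q q′ = transpose-⟨$⟩ʳ-left (transpose p p′ ⟨$⟩ʳ q) q′

twoPointPermutation-p : (p p′ q q′ : Fin n) → (p ≡ q → p′ ≡ q′) → (p′ ≡ q′ → p ≡ q) →
                        twoPointPermutation p p′ q q′ ⟨$⟩ʳ p ≡ p′
twoPointPermutation-p p p′ q q′ p≡q⇒ ⇒p≡q with p ≟ q
... | yes refl = trans (twoPointPermutation-q p p′ p q′) (sym (p≡q⇒ refl))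
... | no p≢q   = trans (cong (transpose t q′ ⟨$⟩ʳ_) (transpose-⟨$⟩ʳ-left p p′))
                   (transpose-⟨$⟩ʳ-other t q′ p′
                     (λ p′≡t → p≢q (⟨$⟩ʳ-injective (transpose p p′) (trans (transpose-⟨$⟩ʳ-left p p′) p′≡t)))
                     (p≢q ∘ ⇒p≡q))
  where t = transpose p p′ ⟨$⟩ʳ q

≈-sym : {G H : Graph} → G ≈ H → H ≈ G
≈-sym {G} {H} (cG , cH , XG , XH , bipG , bipH , XG≤ , XH≤ , ∣X∣≡ , ∣∁X∣≡ , η , η⊆ , η-inj , η-surj , η-size) =
  cH , cG , XH , XG , bipH , bipG , XH≤ , XG≤ , sym ∣X∣≡ , sym ∣∁X∣≡ ,
  θ , (λ T T⊆ → proj₁ (θ-spec T T⊆)) , θ-inj , θ-surj , θ-size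
  where
  θ : Subset (N H) → Subset (N G)
  θ T with T ⊆? XH
  ... | yes T⊆ = proj₁ (η-surj T T⊆)
  ... | no _   = ∅   -- junk value; θ is only used on subsets of XH

  θ-spec : ∀ T → T ⊆ XH → θ T ⊆ XG × η (θ T) ≡ T
  θ-spec T T⊆ with T ⊆? XH
  ... | yes T⊆′ = proj₂ (η-surj T T⊆′)
  ... | no T⊈   = contradiction (λ {x} → T⊆ {x}) T⊈

  θ-inj : ∀ T T′ → T ⊆ XH → T′ ⊆ XH → θ T ≡ θ T′ → T ≡ T′
  θ-inj T T′ T⊆ T′⊆ eq = begin
    T          ≡⟨ proj₂ (θ-spec T T⊆) ⟨
    η (θ T)    ≡⟨ cong η eq ⟩
    η (θ T′)   ≡⟨ proj₂ (θ-spec T′ T′⊆) ⟩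
    T′         ∎
    where open ≡-Reasoning

  θ-surj : ∀ S → S ⊆ XG → ∃ λ T → T ⊆ XH × θ T ≡ S
  θ-surj S S⊆ = η S , η⊆ S S⊆ ,
    η-inj (θ (η S)) S (proj₁ (θ-spec (η S) (η⊆ S S⊆))) S⊆ (proj₂ (θ-spec (η S) (η⊆ S S⊆)))

  θ-size : ∀ T → T ⊆ XH → ∣ θ T ∣ ≡ ∣ T ∣ × ∣ Nbhd G (θ T) ∣ ≡ ∣ Nbhd H T ∣
  θ-size T T⊆ = let θT⊆ , ηθT≡T = θ-spec T T⊆
                    ∣ηθT∣ , ∣NηθT∣ = η-size (θ T) θT⊆
                in trans (sym ∣ηθT∣) (cong ∣_∣ ηθT≡T) , trans (sym ∣NηθT∣) (cong (∣_∣ ∘ Nbhd H) ηθT≡T)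

Reach-trans : ∀ {G u v w} → Reach G u v → Reach G v w → Reach G u w
Reach-trans here         r = r
Reach-trans (step uv r′) r = step uv (Reach-trans r′ r)

∣∣≡count-lookup : (S : Subset n) → ∣ S ∣ ≡ count (lookup S)
∣∣≡count-lookup []          = refl
∣∣≡count-lookup (true ∷ S)  = cong suc (∣∣≡count-lookup S)
∣∣≡count-lookup (false ∷ S) = ∣∣≡count-lookup S

module Enumeration {N : ℕ} {V : Set} (decode : Fin N → V) (encode : V → Fin N)
  (decode-encode : ∀ v → decode (encode v) ≡ v) (encode-decode : ∀ k → encode (decode k) ≡ k) where

  χ : Subset N → V → Bool
  χ S v = lookup S (encode v)

  fromχ : (V → Bool) → Subset N
  fromχ P = tabulate (P ∘ decode)

  χ-fromχ : (P : V → Bool) → χ (fromχ P) ≗ P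
  χ-fromχ P v = trans (Vec.lookup∘tabulate (P ∘ decode) (encode v)) (cong P (decode-encode v))

  fromχ-cong : {P Q : V → Bool} → P ≗ Q → fromχ P ≡ fromχ Q
  fromχ-cong P≗Q = Vec.tabulate-cong (P≗Q ∘ decode)

  χ-injective : {S T : Subset N} → χ S ≗ χ T → S ≡ T
  χ-injective {S} {T} χS≗χT = begin
    S                      ≡⟨ Vec.tabulate∘lookup S ⟨
    tabulate (lookup S)    ≡⟨ Vec.tabulate-cong lookupS≗lookupT ⟩
    tabulate (lookup T)    ≡⟨ Vec.tabulate∘lookup T ⟩
    T                      ∎
    where
    open ≡-Reasoning
    lookupS≗lookupT : lookup S ≗ lookup T
    lookupS≗lookupT k = subst (λ k′ → lookup S k′ ≡ lookup T k′) (encode-decode k) (χS≗χT (decode k))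

  χ≡true⇒∈ : {X : Subset N} {v : V} → χ X v ≡ true → encode v ∈ X
  χ≡true⇒∈ {X} = Vec.lookup⇒[]= _ X

  χ≡false⇒∉ : {X : Subset N} {v : V} → χ X v ≡ false → encode v ∉ X
  χ≡false⇒∉ Xv v∈X = contradiction (trans (sym (Vec.[]=⇒lookup v∈X)) Xv) λ ()

  ⊆⇒χ : {S X : Subset N} → S ⊆ X → ∀ v → χ S v ≡ true → χ X v ≡ true
  ⊆⇒χ S⊆X v Sv = Vec.[]=⇒lookup (S⊆X (χ≡true⇒∈ Sv))

  χ⇒⊆ : {S X : Subset N} → (∀ v → χ S v ≡ true → χ X v ≡ true) → S ⊆ X
  χ⇒⊆ {S} {X} χS⇒χX {k} k∈S = Vec.lookup⇒[]= k X
    (subst (λ k′ → lookup X k′ ≡ true) (encode-decode k)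
      (χS⇒χX (decode k) (subst (λ k′ → lookup S k′ ≡ true) (sym (encode-decode k)) (Vec.[]=⇒lookup k∈S))))

  χ-∁ : (X : Subset N) (v : V) → χ (∁ X) v ≡ not (χ X v)
  χ-∁ X v = Vec.lookup-map (encode v) not X

  ∣∣≡count : (S : Subset N) → ∣ S ∣ ≡ count (χ S ∘ decode)
  ∣∣≡count S = trans (∣∣≡count-lookup S) (count-cong (λ k → cong (lookup S) (sym (encode-decode k))))

  ⊆-χ-false : {S X : Subset N} → S ⊆ X → ∀ v → χ X v ≡ false → χ S v ≡ false
  ⊆-χ-false {S} S⊆X v Xv with χ S v in Sv
  ... | false = refl
  ... | true  = trans (sym (⊆⇒χ S⊆X v Sv)) Xv

  module _ (A : V → V → Bool) where

    graph : Graph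
    graph = record { N = N ; adj = λ u v → A (decode u) (decode v) }

    χ-Nbhd : (S : Subset N) (v : V) → χ (Nbhd graph S) v ≡ anyᶠ (λ k → χ S (decode k) ∧ A (decode k) v)
    χ-Nbhd S v = trans (Vec.lookup∘tabulate _ (encode v))
      (anyᶠ-cong (λ k → cong₂ _∧_ (cong (lookup S) (sym (encode-decode k))) (cong (A (decode k)) (decode-encode v))))

    adj-encode : ∀ {x y} → A x y ≡ true → adj graph (encode x) (encode y) ≡ true
    adj-encode {x} {y} = subst₂ (λ u v → A u v ≡ true) (sym (decode-encode x)) (sym (decode-encode y))

    bipartition-edge : {X : Subset N} → IsBipartition graph X → ∀ {x y} → A x y ≡ true → χ X x ≡ not (χ X y)
    bipartition-edge {X} bip {x} {y} Axy with χ X x in Xx | χ X y in Xy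
    ... | true  | false = refl
    ... | false | true  = refl
    ... | true  | true  = contradiction (χ≡true⇒∈ Xy) (proj₁ (bip _ _ (adj-encode Axy)) (χ≡true⇒∈ Xx))
    ... | false | false = contradiction (proj₂ (bip _ _ (adj-encode Axy)) (χ≡false⇒∉ Xx)) (χ≡false⇒∉ Xy)

    fromχ-bipartition : (P : V → Bool) → (∀ x y → A x y ≡ true → P x ≡ not (P y)) → IsBipartition graph (fromχ P)
    fromχ-bipartition P P-edge u v Auv = u∈⇒v∉ , u∉⇒v∈
      where
      ∈⇒P : ∀ {k} → k ∈ fromχ P → P (decode k) ≡ true
      ∈⇒P {k} k∈ = trans (sym (Vec.lookup∘tabulate (P ∘ decode) k)) (Vec.[]=⇒lookup k∈)
      P⇒∈ : ∀ {k} → P (decode k) ≡ true → k ∈ fromχ P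
      P⇒∈ {k} Pk = Vec.lookup⇒[]= k (fromχ P) (trans (Vec.lookup∘tabulate (P ∘ decode) k) Pk)
      u∈⇒v∉ : u ∈ fromχ P → v ∉ fromχ P
      u∈⇒v∉ u∈ v∈ = contradiction (trans (sym (∈⇒P u∈)) (trans (P-edge _ _ Auv) (cong not (∈⇒P v∈)))) λ ()
      u∉⇒v∈ : u ∉ fromχ P → v ∈ fromχ P
      u∉⇒v∈ u∉ with P (decode v) in Pv
      ... | true  = P⇒∈ Pv
      ... | false = contradiction (P⇒∈ (trans (P-edge _ _ Auv) (cong not Pv))) u∉

    connected-via : (h : V) → (∀ x → Reach graph (encode x) (encode h)) → (∀ x → Reach graph (encode h) (encode x)) →
                    Connected graph
    connected-via h to-h from-h u v = subst₂ (Reach graph) (encode-decode u) (encode-decode v)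
      (Reach-trans (to-h (decode u)) (from-h (decode v)))

remQuot⇒combine : ∀ {m} {k : Fin (m * n)} {q i} → remQuot {m} n k ≡ (q , i) → combine q i ≡ k
remQuot⇒combine {n} {m} {k} eq = trans (cong (uncurry combine) (sym eq)) (Fin.combine-remQuot {m} n k)

splitAt⇒join : ∀ {m} {k : Fin (m + n)} {x} → splitAt m k ≡ x → join m n x ≡ k
splitAt⇒join {n} {m} {k} eq = trans (cong (join m n) (sym eq)) (Fin.join-splitAt m n k)

encode⁻ : V⁻ n → Fin (4 * n)
encode⁻ (a i) = combine {4} zero i
encode⁻ (b i) = combine {4} (suc zero) i
encode⁻ (c i) = combine {4} (suc (suc zero)) i
encode⁻ (d i) = combine {4} (suc (suc (suc zero))) i

decode⁻-encode⁻ : (v : V⁻ n) → decode⁻ n (encode⁻ v) ≡ v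
decode⁻-encode⁻ {n} (a i) rewrite Fin.remQuot-combine {4} {n} zero i                   = refl
decode⁻-encode⁻ {n} (b i) rewrite Fin.remQuot-combine {4} {n} (suc zero) i             = refl
decode⁻-encode⁻ {n} (c i) rewrite Fin.remQuot-combine {4} {n} (suc (suc zero)) i       = refl
decode⁻-encode⁻ {n} (d i) rewrite Fin.remQuot-combine {4} {n} (suc (suc (suc zero))) i = refl

encode⁻-decode⁻ : (k : Fin (4 * n)) → encode⁻ (decode⁻ n k) ≡ k
encode⁻-decode⁻ {n} k with remQuot {4} n k in eq
... | zero                 , i = remQuot⇒combine eq
... | suc zero             , i = remQuot⇒combine eq
... | suc (suc zero)       , i = remQuot⇒combine eq
... | suc (suc (suc zero)) , i = remQuot⇒combine eq

encode : V n → Fin (4 * n + 3)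
encode (old x) = encode⁻ x ↑ˡ 3
encode {n} e   = (4 * n) ↑ʳ zero
encode {n} f   = (4 * n) ↑ʳ suc zero
encode {n} g   = (4 * n) ↑ʳ suc (suc zero)

decode-old : (k : Fin (4 * n)) → decode n (k ↑ˡ 3) ≡ old (decode⁻ n k)
decode-old {n} k rewrite Fin.splitAt-↑ˡ (4 * n) k 3 = refl

decode-encode : (v : V n) → decode n (encode v) ≡ v
decode-encode     (old x) = trans (decode-old (encode⁻ x)) (cong old (decode⁻-encode⁻ x))
decode-encode {n} e rewrite Fin.splitAt-↑ʳ (4 * n) 3 zero             = refl
decode-encode {n} f rewrite Fin.splitAt-↑ʳ (4 * n) 3 (suc zero)       = refl
decode-encode {n} g rewrite Fin.splitAt-↑ʳ (4 * n) 3 (suc (suc zero)) = refl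

encode-decode : (k : Fin (4 * n + 3)) → encode (decode n k) ≡ k
encode-decode {n} k with splitAt (4 * n) k in eq
... | inj₁ x                = trans (cong (_↑ˡ 3) (encode⁻-decode⁻ {n} x)) (splitAt⇒join {m = 4 * n} eq)
... | inj₂ zero             = splitAt⇒join {m = 4 * n} eq
... | inj₂ (suc zero)       = splitAt⇒join {m = 4 * n} eq
... | inj₂ (suc (suc zero)) = splitAt⇒join {m = 4 * n} eq

-- The trailing false and 0 are those of the folds over Fin 4 in anyᶠ-* and count-*.
anyV⁻ : (V⁻ n → Bool) → Bool
anyV⁻ h = anyᶠ (h ∘ a) ∨ (anyᶠ (h ∘ b) ∨ (anyᶠ (h ∘ c) ∨ (anyᶠ (h ∘ d) ∨ false)))

count⁻ : (V⁻ n → Bool) → ℕ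
count⁻ h = count (h ∘ a) + (count (h ∘ b) + (count (h ∘ c) + (count (h ∘ d) + 0)))

anyV : (V n → Bool) → Bool
anyV h = anyV⁻ (h ∘ old) ∨ (h e ∨ (h f ∨ (h g ∨ false)))

countV : (V n → Bool) → ℕ
countV h = count⁻ (h ∘ old) + (𝟙 (h e) + (𝟙 (h f) + (𝟙 (h g) + 0)))

anyᶠ-decode⁻ : (h : V⁻ n → Bool) → anyᶠ (h ∘ decode⁻ n) ≡ anyV⁻ h
anyᶠ-decode⁻ {n} h = trans (anyᶠ-* 4 {n} (h ∘ decode⁻ n))
  (cong₂ _∨_ (part a) (cong₂ _∨_ (part b) (cong₂ _∨_ (part c) (cong₂ _∨_ (part d) refl))))
  where
  part : (p : Fin n → V⁻ n) → anyᶠ (h ∘ decode⁻ n ∘ encode⁻ ∘ p) ≡ anyᶠ (h ∘ p)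
  part p = anyᶠ-cong (cong h ∘ decode⁻-encode⁻ ∘ p)

count-decode⁻ : (h : V⁻ n → Bool) → count (h ∘ decode⁻ n) ≡ count⁻ h
count-decode⁻ {n} h = trans (count-* 4 {n} (h ∘ decode⁻ n))
  (cong₂ _+_ (part a) (cong₂ _+_ (part b) (cong₂ _+_ (part c) (cong₂ _+_ (part d) refl))))
  where
  part : (p : Fin n → V⁻ n) → count (h ∘ decode⁻ n ∘ encode⁻ ∘ p) ≡ count (h ∘ p)
  part p = count-cong (cong h ∘ decode⁻-encode⁻ ∘ p)

anyᶠ-decode : (h : V n → Bool) → anyᶠ (h ∘ decode n) ≡ anyV h
anyᶠ-decode {n} h = trans (anyᶠ-+ (4 * n) (h ∘ decode n))
  (cong₂ _∨_ (trans (anyᶠ-cong (cong h ∘ decode-old)) (anyᶠ-decode⁻ (h ∘ old)))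
             (cong₂ _∨_ (new e) (cong₂ _∨_ (new f) (cong₂ _∨_ (new g) refl))))
  where
  new : (v : V n) → h (decode n (encode v)) ≡ h v
  new = cong h ∘ decode-encode

count-decode : (h : V n → Bool) → count (h ∘ decode n) ≡ countV h
count-decode {n} h = trans (count-+ (4 * n) (h ∘ decode n))
  (cong₂ _+_ (trans (count-cong (cong h ∘ decode-old)) (count-decode⁻ (h ∘ old)))
             (cong₂ _+_ (new e) (cong₂ _+_ (new f) (cong₂ _+_ (new g) refl))))
  where
  new : (v : V n) → 𝟙 (h (decode n (encode v))) ≡ 𝟙 (h v)
  new = cong (𝟙 ∘ h) ∘ decode-encode

count⁻-cong : {h h′ : V⁻ n → Bool} → h ≗ h′ → count⁻ h ≡ count⁻ h′
count⁻-cong {n} {h} {h′} h≗h′ = trans (sym (count-decode⁻ h)) (trans (count-cong (h≗h′ ∘ decode⁻ n)) (count-decode⁻ h′))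

anyV⁻-cong : {h h′ : V⁻ n → Bool} → h ≗ h′ → anyV⁻ h ≡ anyV⁻ h′
anyV⁻-cong {n} {h} {h′} h≗h′ = trans (sym (anyᶠ-decode⁻ h)) (trans (anyᶠ-cong (h≗h′ ∘ decode⁻ n)) (anyᶠ-decode⁻ h′))

countV-cong : {h h′ : V n → Bool} → h ≗ h′ → countV h ≡ countV h′
countV-cong {n} {h} {h′} h≗h′ = trans (sym (count-decode h)) (trans (count-cong (h≗h′ ∘ decode n)) (count-decode h′))

anyV-cong : {h h′ : V n → Bool} → h ≗ h′ → anyV h ≡ anyV h′
anyV-cong {n} {h} {h′} h≗h′ = trans (sym (anyᶠ-decode h)) (trans (anyᶠ-cong (h≗h′ ∘ decode n)) (anyᶠ-decode h′))

-- The graph G⁻_π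

data Side : Set where
  AC BD : Side

opposite : Side → Side
opposite AC = BD
opposite BD = AC

part₁ part₂ : Side → Fin n → V⁻ n
part₁ AC = a
part₁ BD = b
part₂ AC = c
part₂ BD = d

on : Side → (P Q : Fin n → Bool) → V⁻ n → Bool
on AC P Q (a m) = P m
on AC P Q (c m) = Q m
on BD P Q (b m) = P m
on BD P Q (d m) = Q m
on _  _ _ _     = false

nbhd₁ nbhd₂ : Permutation′ n → (P Q : Fin n → Bool) → Fin n → Bool
nbhd₁ ρ P Q m = anyᶠ (P ─ m) ∨ Q (ρ ⟨$⟩ʳ m)
nbhd₂ ρ P Q m = P (ρ ⟨$⟩ʳ m) ∨ anyᶠ (Q ─ m)

ρ₁ ρ₂ : Side → Permutation′ n → Permutation′ n
ρ₁ AC π = id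
ρ₁ BD π = π
ρ₂ AC π = flip π
ρ₂ BD π = id

nbhd₁-cong : (ρ : Permutation′ n) {P P′ Q Q′ : Fin n → Bool} → P ≗ P′ → Q ≗ Q′ → nbhd₁ ρ P Q ≗ nbhd₁ ρ P′ Q′
nbhd₁-cong ρ P≗ Q≗ m = cong₂ _∨_ (anyᶠ-cong (λ k → cong (_∧ not (k == m)) (P≗ k))) (Q≗ (ρ ⟨$⟩ʳ m))

nbhd₂-cong : (ρ : Permutation′ n) {P P′ Q Q′ : Fin n → Bool} → P ≗ P′ → Q ≗ Q′ → nbhd₂ ρ P Q ≗ nbhd₂ ρ P′ Q′
nbhd₂-cong ρ P≗ Q≗ m = cong₂ _∨_ (P≗ (ρ ⟨$⟩ʳ m)) (anyᶠ-cong (λ k → cong (_∧ not (k == m)) (Q≗ k)))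

nbhd⁻ : Permutation′ n → (V⁻ n → Bool) → V⁻ n → Bool
nbhd⁻ π T y = anyV⁻ (λ x → T x ∧ adj⁻ π x y)

anyV⁻-on : (s : Side) (P Q : Fin n → Bool) (h : V⁻ n → Bool) →
           anyV⁻ (λ x → on s P Q x ∧ h x) ≡ anyᶠ (λ m → P m ∧ h (part₁ s m)) ∨ anyᶠ (λ m → Q m ∧ h (part₂ s m))
anyV⁻-on {n} AC P Q h rewrite anyᶠ-false {n} = cong (anyᶠ (λ m → P m ∧ h (a m)) ∨_) (∨-identityʳ (anyᶠ (λ m → Q m ∧ h (c m))))
anyV⁻-on {n} BD P Q h rewrite anyᶠ-false {n} = cong (anyᶠ (λ m → P m ∧ h (b m)) ∨_) (∨-identityʳ (anyᶠ (λ m → Q m ∧ h (d m))))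

nbhd⁻-on : (π : Permutation′ n) (s : Side) (P Q : Fin n → Bool) →
        nbhd⁻ π (on s P Q) ≗ on (opposite s) (nbhd₁ (ρ₁ s π) P Q) (nbhd₂ (ρ₂ s π) P Q)
nbhd⁻-on π s P Q y = trans (anyV⁻-on s P Q (λ x → adj⁻ π x y)) (by-cases s y)
  where
  by-cases : (s : Side) (y : V⁻ _) →
    anyᶠ (λ m → P m ∧ adj⁻ π (part₁ s m) y) ∨ anyᶠ (λ m → Q m ∧ adj⁻ π (part₂ s m) y)
    ≡ on (opposite s) (nbhd₁ (ρ₁ s π) P Q) (nbhd₂ (ρ₂ s π) P Q) y
  by-cases AC (a m) rewrite anyᶠ-∧-false P | anyᶠ-∧-false Q = refl
  by-cases AC (b m) = cong (anyᶠ (P ─ m) ∨_) (anyᶠ-∧-== Q m)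
  by-cases AC (c m) rewrite anyᶠ-∧-false P | anyᶠ-∧-false Q = refl
  by-cases AC (d k) = cong (_∨ anyᶠ (Q ─ k))
    (trans (anyᶠ-cong (λ m → cong (P m ∧_) (⟨$⟩ʳ-== π m k))) (anyᶠ-∧-== P (π ⟨$⟩ˡ k)))
  by-cases BD (a m) = cong (anyᶠ (P ─ m) ∨_)
    (trans (anyᶠ-cong (λ k → cong (Q k ∧_) (==-sym (π ⟨$⟩ʳ m) k))) (anyᶠ-∧-== Q (π ⟨$⟩ʳ m)))
  by-cases BD (b m) rewrite anyᶠ-∧-false P | anyᶠ-∧-false Q = refl
  by-cases BD (c m) = cong (_∨ anyᶠ (Q ─ m)) (anyᶠ-∧-== P m)
  by-cases BD (d k) rewrite anyᶠ-∧-false P | anyᶠ-∧-false Q = refl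

count⁻-on : (s : Side) (P Q : Fin n → Bool) → count⁻ (on s P Q) ≡ count P + count Q
count⁻-on {n} AC P Q rewrite count-false {n} = cong (count P +_) (+-identityʳ (count Q))
count⁻-on {n} BD P Q rewrite count-false {n} = cong (count P +_) (+-identityʳ (count Q))

on-cong : (s : Side) {P P′ Q Q′ : Fin n → Bool} → P ≗ P′ → Q ≗ Q′ → on s P Q ≗ on s P′ Q′
on-cong AC P≗ Q≗ (a m) = P≗ m
on-cong AC P≗ Q≗ (b m) = refl
on-cong AC P≗ Q≗ (c m) = Q≗ m
on-cong AC P≗ Q≗ (d m) = refl
on-cong BD P≗ Q≗ (a m) = refl
on-cong BD P≗ Q≗ (b m) = P≗ m
on-cong BD P≗ Q≗ (c m) = refl
on-cong BD P≗ Q≗ (d m) = Q≗ m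

on⇒side : (s : Side) {P Q : Fin n → Bool} (v : V⁻ n) → on s P Q v ≡ true → on s (λ _ → true) (λ _ → true) v ≡ true
on⇒side AC (a m) _ = refl
on⇒side AC (c m) _ = refl
on⇒side BD (b m) _ = refl
on⇒side BD (d m) _ = refl

on-part₁ : (s : Side) {P Q : Fin n → Bool} (m : Fin n) → on s P Q (part₁ s m) ≡ P m
on-part₁ AC m = refl
on-part₁ BD m = refl

colouring : Bool → V⁻ n → Bool
colouring t (a _) = t
colouring t (b _) = not t
colouring t (c _) = t
colouring t (d _) = not t

sideOf : Bool → Side
sideOf true  = AC
sideOf false = BD

on-sideOf : (t : Bool) → on (sideOf t) (λ _ → true) (λ _ → true) ≗ colouring {n} t
on-sideOf true  (a _) = refl
on-sideOf true  (b _) = refl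
on-sideOf true  (c _) = refl
on-sideOf true  (d _) = refl
on-sideOf false (a _) = refl
on-sideOf false (b _) = refl
on-sideOf false (c _) = refl
on-sideOf false (d _) = refl

ρ₁-fixed : (s : Side) (π : Permutation′ n) {i : Fin n} → π ⟨$⟩ʳ i ≡ i → ρ₁ s π ⟨$⟩ʳ i ≡ i
ρ₁-fixed AC π πi≡i = refl
ρ₁-fixed BD π πi≡i = πi≡i

ρ₂-fixed : (s : Side) (π : Permutation′ n) {i : Fin n} → π ⟨$⟩ʳ i ≡ i → ρ₂ s π ⟨$⟩ʳ i ≡ i
ρ₂-fixed AC π πi≡i = trans (cong (π ⟨$⟩ˡ_) (sym πi≡i)) (inverseˡ π)
ρ₂-fixed BD π πi≡i = refl

ρ₂ρ₁-fixed⇒fixed : (s : Side) (π : Permutation′ n) {i : Fin n} → ρ₂ s π ⟨$⟩ʳ (ρ₁ s π ⟨$⟩ʳ i) ≡ i → π ⟨$⟩ʳ i ≡ i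
ρ₂ρ₁-fixed⇒fixed AC π π⁻¹i≡i = trans (cong (π ⟨$⟩ʳ_) (sym π⁻¹i≡i)) (inverseʳ π)
ρ₂ρ₁-fixed⇒fixed BD π πi≡i   = πi≡i

nbhd-full⇒singletons : 3 ≤ n → (ρ ρ′ : Permutation′ n) (P Q : Fin n → Bool) → count P + count Q ≡ 2 →
  (∀ m → nbhd₁ ρ P Q m ≡ true) → (∀ m → nbhd₂ ρ′ P Q m ≡ true) →
  ∃ λ i → P ≗ (_== i) × Q ≗ (_== (ρ ⟨$⟩ʳ i)) × ρ′ ⟨$⟩ʳ (ρ ⟨$⟩ʳ i) ≡ i
nbhd-full⇒singletons {n} 3≤n ρ ρ′ P Q ∣P∣+∣Q∣≡2 full₁ full₂ with count P in ∣P∣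
... | 0 = contradiction (trans (sym ∣P∣+∣Q∣≡2) (trans (sym (count-permute Q ρ)) (count-all _ Qρ-full))) (<⇒≢ 3≤n)
  where
  Qρ-full : ∀ m → Q (ρ ⟨$⟩ʳ m) ≡ true
  Qρ-full m = trans (cong (_∨ Q (ρ ⟨$⟩ʳ m)) (sym (anyᶠ-─-count≡0 P ∣P∣ m))) (full₁ m)
... | 2 = contradiction (trans (sym ∣P∣) (trans (sym (count-permute P ρ′)) (count-all _ Pρ′-full))) (<⇒≢ 3≤n)
  where
  Pρ′-full : ∀ m → P (ρ′ ⟨$⟩ʳ m) ≡ true
  Pρ′-full m = trans (sym (trans (cong (P (ρ′ ⟨$⟩ʳ m) ∨_) (anyᶠ-─-count≡0 Q (suc-injective (suc-injective ∣P∣+∣Q∣≡2)) m))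
                                 (∨-identityʳ _)))
                     (full₂ m)
... | 1 = i , P≗i , Q≗ρi , trans (cong (ρ′ ⟨$⟩ʳ_) ρi≡j) ρ′j≡i
  where
  i = proj₁ (count≡1⇒singleton P ∣P∣)
  P≗i = proj₂ (count≡1⇒singleton P ∣P∣)
  j = proj₁ (count≡1⇒singleton Q (suc-injective ∣P∣+∣Q∣≡2))
  Q≗j = proj₂ (count≡1⇒singleton Q (suc-injective ∣P∣+∣Q∣≡2))
  ρi≡j : ρ ⟨$⟩ʳ i ≡ j
  ρi≡j = ==⇒≡ (trans (sym (Q≗j (ρ ⟨$⟩ʳ i)))
    (trans (cong (_∨ Q (ρ ⟨$⟩ʳ i)) (sym (trans (anyᶠ-─-singleton P≗i i) (cong not (==-refl i))))) (full₁ i)))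
  ρ′j≡i : ρ′ ⟨$⟩ʳ j ≡ i
  ρ′j≡i = ==⇒≡ (trans (sym (P≗i (ρ′ ⟨$⟩ʳ j)))
    (trans (sym (trans (cong (P (ρ′ ⟨$⟩ʳ j) ∨_) (trans (anyᶠ-─-singleton Q≗j j) (cong not (==-refl j)))) (∨-identityʳ _)))
      (full₂ j)))
  Q≗ρi : Q ≗ (_== (ρ ⟨$⟩ʳ i))
  Q≗ρi m = trans (Q≗j m) (cong (m ==_) (sym ρi≡j))

singletons⇒nbhd-full : (ρ ρ′ : Permutation′ n) {P Q : Fin n → Bool} {i : Fin n} →
  P ≗ (_== i) → Q ≗ (_== (ρ ⟨$⟩ʳ i)) → ρ′ ⟨$⟩ʳ (ρ ⟨$⟩ʳ i) ≡ i →
  (∀ m → nbhd₁ ρ P Q m ≡ true) × (∀ m → nbhd₂ ρ′ P Q m ≡ true)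
singletons⇒nbhd-full ρ ρ′ {P} {Q} {i} P≗i Q≗ρi ρ′ρi≡i = full₁ , full₂
  where
  open ≡-Reasoning
  full₁ : ∀ m → nbhd₁ ρ P Q m ≡ true
  full₁ m = begin
    anyᶠ (P ─ m) ∨ Q (ρ ⟨$⟩ʳ m)  ≡⟨ cong₂ _∨_ (anyᶠ-─-singleton P≗i m) (trans (Q≗ρi (ρ ⟨$⟩ʳ m)) (==-⟨$⟩ʳ ρ m i)) ⟩
    not (i == m) ∨ (m == i)      ≡⟨ cong (not (i == m) ∨_) (==-sym m i) ⟩
    not (i == m) ∨ (i == m)      ≡⟨ ∨-inverseˡ (i == m) ⟩
    true                         ∎
  full₂ : ∀ m → nbhd₂ ρ′ P Q m ≡ true
  full₂ m = begin
    P (ρ′ ⟨$⟩ʳ m) ∨ anyᶠ (Q ─ m)                   ≡⟨ cong₂ _∨_ (P≗i (ρ′ ⟨$⟩ʳ m)) (anyᶠ-─-singleton Q≗ρi m) ⟩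
    ((ρ′ ⟨$⟩ʳ m) == i) ∨ not ((ρ ⟨$⟩ʳ i) == m)     ≡⟨ cong (λ k → ((ρ′ ⟨$⟩ʳ m) == k) ∨ not ((ρ ⟨$⟩ʳ i) == m)) (sym ρ′ρi≡i) ⟩
    ((ρ′ ⟨$⟩ʳ m) == (ρ′ ⟨$⟩ʳ (ρ ⟨$⟩ʳ i))) ∨ not ((ρ ⟨$⟩ʳ i) == m)
                                                   ≡⟨ cong (_∨ not ((ρ ⟨$⟩ʳ i) == m)) (trans (==-⟨$⟩ʳ ρ′ m _) (==-sym m _)) ⟩
    ((ρ ⟨$⟩ʳ i) == m) ∨ not ((ρ ⟨$⟩ʳ i) == m)      ≡⟨ ∨-inverseʳ ((ρ ⟨$⟩ʳ i) == m) ⟩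
    true                                           ∎

isFixed : Permutation′ n → Fin n → Bool
isFixed π i = (π ⟨$⟩ʳ i) == i

module _ {n : ℕ} where

  module E⁻ = Enumeration (decode⁻ n) encode⁻ decode⁻-encode⁻ (encode⁻-decode⁻ {n})

  bipartition-colouring : 3 ≤ n → (π : Permutation′ n) {X : Subset (4 * n)} → IsBipartition (G⁻ π) X →
                       ∃ λ t → E⁻.χ X ≗ colouring t
  bipartition-colouring 3≤n π {X} bip = t , layers
    where
    z : Fin n
    z = fromℕ< (≤-trans (s≤s z≤n) 3≤n)
    t = E⁻.χ X (a z)
    across : ∀ {x y} → adj⁻ π x y ≡ true → E⁻.χ X x ≡ not (E⁻.χ X y)
    across {x} {y} = E⁻.bipartition-edge (adj⁻ π) bip {x} {y}
    ≢⇒not== : {i j : Fin n} → i ≢ j → not (i == j) ≡ true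
    ≢⇒not== = cong not ∘ ≢⇒==-false
    A : ∀ i → E⁻.χ X (a i) ≡ t
    A i = let m , m≢i , m≢z = fresh 3≤n i z in
      trans (across {a i} {b m} (≢⇒not== (m≢i ∘ sym)))
        (trans (cong not (across {b m} {a z} (≢⇒not== m≢z))) (not-involutive t))
    B : ∀ m → E⁻.χ X (b m) ≡ not t
    B m = let i , i≢m , _ = fresh 3≤n m m in trans (across {b m} {a i} (≢⇒not== (i≢m ∘ sym))) (cong not (A i))
    C : ∀ m → E⁻.χ X (c m) ≡ t
    C m = trans (across {c m} {b m} (==-refl m)) (trans (cong not (B m)) (not-involutive t))
    D : ∀ k → E⁻.χ X (d k) ≡ not t
    D k = let m , m≢k , _ = fresh 3≤n k k in trans (across {d k} {c m} (≢⇒not== (m≢k ∘ sym))) (cong not (C m))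
    layers : E⁻.χ X ≗ colouring t
    layers (a i) = A i
    layers (b m) = B m
    layers (c m) = C m
    layers (d k) = D k

  bipartition-side : 3 ≤ n → (π : Permutation′ n) {X : Subset (4 * n)} → IsBipartition (G⁻ π) X →
                     ∃ λ s → E⁻.χ X ≗ on s (λ _ → true) (λ _ → true)
  bipartition-side 3≤n π bip = let t , layers = bipartition-colouring 3≤n π bip in
    sideOf t , λ v → trans (layers v) (sym (on-sideOf t v))

  ⊆side⇒on : (s : Side) {X S : Subset (4 * n)} → E⁻.χ X ≗ on s (λ _ → true) (λ _ → true) → S ⊆ X →
             E⁻.χ S ≗ on s (E⁻.χ S ∘ part₁ s) (E⁻.χ S ∘ part₂ s)
  ⊆side⇒on AC X≗ S⊆X (a m) = refl
  ⊆side⇒on AC X≗ S⊆X (b m) = E⁻.⊆-χ-false S⊆X (b m) (X≗ (b m))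
  ⊆side⇒on AC X≗ S⊆X (c m) = refl
  ⊆side⇒on AC X≗ S⊆X (d m) = E⁻.⊆-χ-false S⊆X (d m) (X≗ (d m))
  ⊆side⇒on BD X≗ S⊆X (a m) = E⁻.⊆-χ-false S⊆X (a m) (X≗ (a m))
  ⊆side⇒on BD X≗ S⊆X (b m) = refl
  ⊆side⇒on BD X≗ S⊆X (c m) = E⁻.⊆-χ-false S⊆X (c m) (X≗ (c m))
  ⊆side⇒on BD X≗ S⊆X (d m) = refl

  ∣∣≡count⁻ : (S : Subset (4 * n)) → ∣ S ∣ ≡ count⁻ (E⁻.χ S)
  ∣∣≡count⁻ S = trans (E⁻.∣∣≡count S) (count-decode⁻ (E⁻.χ S))

  χ-Nbhd⁻ : (π : Permutation′ n) (S : Subset (4 * n)) → E⁻.χ (Nbhd (G⁻ π) S) ≗ nbhd⁻ π (E⁻.χ S)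
  χ-Nbhd⁻ π S v = trans (E⁻.χ-Nbhd (adj⁻ π) S v) (anyᶠ-decode⁻ (λ x → E⁻.χ S x ∧ adj⁻ π x v))

  on-sizes : (π : Permutation′ n) (s : Side) {S : Subset (4 * n)} {P Q : Fin n → Bool} → E⁻.χ S ≗ on s P Q →
             ∣ S ∣ ≡ count P + count Q ×
             ∣ Nbhd (G⁻ π) S ∣ ≡ count (nbhd₁ (ρ₁ s π) P Q) + count (nbhd₂ (ρ₂ s π) P Q)
  on-sizes π s {S} {P} {Q} S≗ =
    trans (∣∣≡count⁻ S) (trans (count⁻-cong S≗) (count⁻-on s P Q)) ,
    trans (∣∣≡count⁻ (Nbhd (G⁻ π) S)) (trans (count⁻-cong NS≗) (count⁻-on (opposite s) (nbhd₁ (ρ₁ s π) P Q) (nbhd₂ (ρ₂ s π) P Q)))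
    where
    NS≗ : E⁻.χ (Nbhd (G⁻ π) S) ≗ on (opposite s) (nbhd₁ (ρ₁ s π) P Q) (nbhd₂ (ρ₂ s π) P Q)
    NS≗ v = trans (χ-Nbhd⁻ π S v)
      (trans (anyV⁻-cong (λ x → cong (_∧ adj⁻ π x v) (S≗ x))) (nbhd⁻-on π s P Q v))

  pair : Side → Fin n → Subset (4 * n)
  pair s i = E⁻.fromχ (on s (_== i) (_== i))

  pair-injective : (s : Side) {i j : Fin n} → pair s i ≡ pair s j → i ≡ j
  pair-injective s {i} {j} eq = ==⇒≡ (begin
    (i == j)                          ≡⟨ on-part₁ s i ⟨
    on s (_== j) (_== j) (part₁ s i)  ≡⟨ E⁻.χ-fromχ (on s (_== j) (_== j)) (part₁ s i) ⟨
    E⁻.χ (pair s j) (part₁ s i)       ≡⟨ cong (λ S → E⁻.χ S (part₁ s i)) eq ⟨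
    E⁻.χ (pair s i) (part₁ s i)       ≡⟨ E⁻.χ-fromχ (on s (_== i) (_== i)) (part₁ s i) ⟩
    on s (_== i) (_== i) (part₁ s i)  ≡⟨ on-part₁ s i ⟩
    (i == i)                          ≡⟨ ==-refl i ⟩
    true                              ∎)
    where open ≡-Reasoning

  pair-dominating : (π : Permutation′ n) (s : Side) {X : Subset (4 * n)} → E⁻.χ X ≗ on s (λ _ → true) (λ _ → true) →
                  {i : Fin n} → π ⟨$⟩ʳ i ≡ i →
                  pair s i ⊆ X × ∣ pair s i ∣ ≡ 2 × ∣ Nbhd (G⁻ π) (pair s i) ∣ ≡ n + n
  pair-dominating π s {X} X≗ {i} πi≡i =
    E⁻.χ⇒⊆ (λ v pv → trans (X≗ v) (on⇒side s v (trans (sym (E⁻.χ-fromχ (on s (_== i) (_== i)) v)) pv))) ,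
    trans (proj₁ sizes) (cong₂ _+_ (count-singleton i) (count-singleton i)) ,
    trans (proj₂ sizes) (cong₂ _+_ (count-all _ (proj₁ full)) (count-all _ (proj₂ full)))
    where
    sizes : ∣ pair s i ∣ ≡ count (_== i) + count (_== i) ×
            ∣ Nbhd (G⁻ π) (pair s i) ∣ ≡ count (nbhd₁ (ρ₁ s π) (_== i) (_== i)) + count (nbhd₂ (ρ₂ s π) (_== i) (_== i))
    sizes = on-sizes π s {pair s i} (E⁻.χ-fromχ (on s (_== i) (_== i)))
    full : (∀ m → nbhd₁ (ρ₁ s π) (_== i) (_== i) m ≡ true) × (∀ m → nbhd₂ (ρ₂ s π) (_== i) (_== i) m ≡ true)
    full = singletons⇒nbhd-full (ρ₁ s π) (ρ₂ s π) (λ _ → refl) (λ m → cong (m ==_) (sym (ρ₁-fixed s π πi≡i)))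
             (trans (cong (ρ₂ s π ⟨$⟩ʳ_) (ρ₁-fixed s π πi≡i)) (ρ₂-fixed s π πi≡i))

  dominating⇒pair : 3 ≤ n → (π : Permutation′ n) (s : Side) {X S : Subset (4 * n)} →
                  E⁻.χ X ≗ on s (λ _ → true) (λ _ → true) → S ⊆ X → ∣ S ∣ ≡ 2 → ∣ Nbhd (G⁻ π) S ∣ ≡ n + n →
                  ∃ λ i → π ⟨$⟩ʳ i ≡ i × S ≡ pair s i
  dominating⇒pair 3≤n π s {X} {S} X≗ S⊆X ∣S∣≡2 ∣NS∣≡2n = i , πi≡i , E⁻.χ-injective S≗pair
    where
    P Q : Fin n → Bool
    P = E⁻.χ S ∘ part₁ s
    Q = E⁻.χ S ∘ part₂ s
    S≗ : E⁻.χ S ≗ on s P Q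
    S≗ = ⊆side⇒on s {X} {S} X≗ S⊆X
    sizes : ∣ S ∣ ≡ count P + count Q × ∣ Nbhd (G⁻ π) S ∣ ≡ count (nbhd₁ (ρ₁ s π) P Q) + count (nbhd₂ (ρ₂ s π) P Q)
    sizes = on-sizes π s {S} S≗
    full : (∀ m → nbhd₁ (ρ₁ s π) P Q m ≡ true) × (∀ m → nbhd₂ (ρ₂ s π) P Q m ≡ true)
    full = count+count≡n+n⇒all _ _ (trans (sym (proj₂ sizes)) ∣NS∣≡2n)
    singletons : ∃ λ i → P ≗ (_== i) × Q ≗ (_== (ρ₁ s π ⟨$⟩ʳ i)) × ρ₂ s π ⟨$⟩ʳ (ρ₁ s π ⟨$⟩ʳ i) ≡ i
    singletons = nbhd-full⇒singletons 3≤n (ρ₁ s π) (ρ₂ s π) P Q (trans (sym (proj₁ sizes)) ∣S∣≡2)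
                   (proj₁ full) (proj₂ full)
    i = proj₁ singletons
    πi≡i : π ⟨$⟩ʳ i ≡ i
    πi≡i = ρ₂ρ₁-fixed⇒fixed s π (proj₂ (proj₂ (proj₂ singletons)))
    S≗pair : E⁻.χ S ≗ E⁻.χ (pair s i)
    S≗pair v = begin
      E⁻.χ S v                         ≡⟨ S≗ v ⟩
      on s P Q v                       ≡⟨ on-cong s (proj₁ (proj₂ singletons)) Q≗i v ⟩
      on s (_== i) (_== i) v           ≡⟨ E⁻.χ-fromχ (on s (_== i) (_== i)) v ⟨
      E⁻.χ (pair s i) v                ∎
      where
      open ≡-Reasoning
      Q≗i : Q ≗ (_== i)
      Q≗i m = trans (proj₁ (proj₂ (proj₂ singletons)) m) (cong (m ==_) (ρ₁-fixed s π πi≡i))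

  ≈⇒fixedPoints≤ : 3 ≤ n → (π₁ π₂ : Permutation′ n) → G⁻ π₁ ≈ G⁻ π₂ → count (isFixed π₁) ≤ count (isFixed π₂)
  ≈⇒fixedPoints≤ 3≤n π₁ π₂ (_ , _ , X₁ , X₂ , bip₁ , bip₂ , _ , _ , _ , _ , η , η⊆ , η-inj , _ , η-size) =
    injection⇒count≤ (isFixed π₁) (isFixed π₂) (λ i fix → proj₁ (image i fix))
      (λ i fix → ≡⇒== (proj₁ (proj₂ (image i fix)))) image-injective
    where
    side₁ = bipartition-side 3≤n π₁ bip₁
    side₂ = bipartition-side 3≤n π₂ bip₂
    s₁ = proj₁ side₁
    s₂ = proj₁ side₂
    dominating : ∀ i → isFixed π₁ i ≡ true →
                 pair s₁ i ⊆ X₁ × ∣ pair s₁ i ∣ ≡ 2 × ∣ Nbhd (G⁻ π₁) (pair s₁ i) ∣ ≡ n + n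
    dominating i fix = pair-dominating π₁ s₁ (proj₂ side₁) (==⇒≡ fix)
    image : ∀ i → isFixed π₁ i ≡ true → ∃ λ j → π₂ ⟨$⟩ʳ j ≡ j × η (pair s₁ i) ≡ pair s₂ j
    image i fix = let pair⊆ , ∣pair∣ , ∣Npair∣ = dominating i fix
                      ∣ηpair∣ , ∣Nηpair∣ = η-size _ pair⊆
                  in dominating⇒pair 3≤n π₂ s₂ (proj₂ side₂) (η⊆ _ pair⊆) (trans ∣ηpair∣ ∣pair∣) (trans ∣Nηpair∣ ∣Npair∣)
    image-injective : ∀ i i′ fix fix′ → proj₁ (image i fix) ≡ proj₁ (image i′ fix′) → i ≡ i′
    image-injective i i′ fix fix′ j≡j′ =
      pair-injective s₁ (η-inj _ _ (proj₁ (dominating i fix)) (proj₁ (dominating i′ fix′)) (begin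
        η (pair s₁ i)                    ≡⟨ proj₂ (proj₂ (image i fix)) ⟩
        pair s₂ (proj₁ (image i fix))    ≡⟨ cong (pair s₂) j≡j′ ⟩
        pair s₂ (proj₁ (image i′ fix′))  ≡⟨ proj₂ (proj₂ (image i′ fix′)) ⟨
        η (pair s₁ i′)                   ∎))
      where open ≡-Reasoning

  ≈⇒fixedPoints≡ : 3 ≤ n → (π₁ π₂ : Permutation′ n) → G⁻ π₁ ≈ G⁻ π₂ → count (isFixed π₁) ≡ count (isFixed π₂)
  ≈⇒fixedPoints≡ 3≤n π₁ π₂ G⁻≈ = ≤-antisym (≈⇒fixedPoints≤ 3≤n π₁ π₂ G⁻≈) (≈⇒fixedPoints≤ 3≤n π₂ π₁ (≈-sym G⁻≈))

-- The graph G_π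

extend : (V⁻ n → Bool) → (ε φ γ : Bool) → V n → Bool
extend T ε φ γ (old x) = T x
extend T ε φ γ e       = ε
extend T ε φ γ f       = φ
extend T ε φ γ g       = γ

inXπ : V n → Bool
inXπ = extend (on AC (λ _ → true) (λ _ → true)) true false false

adj⁻-crosses-AC : {π : Permutation′ n} (x y : V⁻ n) → adj⁻ π x y ≡ true →
                  on AC (λ _ → true) (λ _ → true) x ≡ not (on AC (λ _ → true) (λ _ → true) y)
adj⁻-crosses-AC (a _) (a _) ()
adj⁻-crosses-AC (a _) (b _) _ = refl
adj⁻-crosses-AC (a _) (c _) ()
adj⁻-crosses-AC (a _) (d _) _ = refl
adj⁻-crosses-AC (b _) (a _) _ = refl
adj⁻-crosses-AC (b _) (b _) ()
adj⁻-crosses-AC (b _) (c _) _ = refl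
adj⁻-crosses-AC (b _) (d _) ()
adj⁻-crosses-AC (c _) (a _) ()
adj⁻-crosses-AC (c _) (b _) _ = refl
adj⁻-crosses-AC (c _) (c _) ()
adj⁻-crosses-AC (c _) (d _) _ = refl
adj⁻-crosses-AC (d _) (a _) _ = refl
adj⁻-crosses-AC (d _) (b _) ()
adj⁻-crosses-AC (d _) (c _) _ = refl
adj⁻-crosses-AC (d _) (d _) ()

adjV-crosses-Xπ : {π : Permutation′ n} (x y : V n) → adjV π x y ≡ true → inXπ x ≡ not (inXπ y)
adjV-crosses-Xπ (old x) (old y) = adj⁻-crosses-AC x y
adjV-crosses-Xπ (old (a _)) e ()
adjV-crosses-Xπ (old (a _)) f _ = refl
adjV-crosses-Xπ (old (a _)) g ()
adjV-crosses-Xπ (old (b _)) e _ = refl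
adjV-crosses-Xπ (old (b _)) f ()
adjV-crosses-Xπ (old (b _)) g ()
adjV-crosses-Xπ (old (c _)) e ()
adjV-crosses-Xπ (old (c _)) f _ = refl
adjV-crosses-Xπ (old (c _)) g _ = refl
adjV-crosses-Xπ (old (d _)) e _ = refl
adjV-crosses-Xπ (old (d _)) f ()
adjV-crosses-Xπ (old (d _)) g ()
adjV-crosses-Xπ e (old (a _)) ()
adjV-crosses-Xπ e (old (b _)) _ = refl
adjV-crosses-Xπ e (old (c _)) ()
adjV-crosses-Xπ e (old (d _)) _ = refl
adjV-crosses-Xπ e e ()
adjV-crosses-Xπ e f _ = refl
adjV-crosses-Xπ e g _ = refl
adjV-crosses-Xπ f (old (a _)) _ = refl
adjV-crosses-Xπ f (old (b _)) ()
adjV-crosses-Xπ f (old (c _)) _ = refl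
adjV-crosses-Xπ f (old (d _)) ()
adjV-crosses-Xπ f e _ = refl
adjV-crosses-Xπ f f ()
adjV-crosses-Xπ f g ()
adjV-crosses-Xπ g (old (a _)) ()
adjV-crosses-Xπ g (old (b _)) ()
adjV-crosses-Xπ g (old (c _)) _ = refl
adjV-crosses-Xπ g (old (d _)) ()
adjV-crosses-Xπ g e _ = refl
adjV-crosses-Xπ g f ()
adjV-crosses-Xπ g g ()

not-inXπ : (v : V n) → not (inXπ v) ≡ extend (on BD (λ _ → true) (λ _ → true)) false true true v
not-inXπ (old (a _)) = refl
not-inXπ (old (b _)) = refl
not-inXπ (old (c _)) = refl
not-inXπ (old (d _)) = refl
not-inXπ e           = refl
not-inXπ f           = refl
not-inXπ g           = refl

extend-cong : {T T′ : V⁻ n → Bool} {ε φ γ : Bool} → T ≗ T′ → extend T ε φ γ ≗ extend T′ ε φ γ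
extend-cong T≗ (old x) = T≗ x
extend-cong T≗ e       = refl
extend-cong T≗ f       = refl
extend-cong T≗ g       = refl

nbhdSizeπ : Permutation′ n → (I J : Fin n → Bool) → Bool → ℕ
nbhdSizeπ π I J ε = count (λ m → nbhd₁ id I J m ∨ ε) + count (λ k → nbhd₂ (flip π) I J k ∨ ε)
                    + (𝟙 ((anyᶠ I ∨ anyᶠ J) ∨ ε) + 𝟙 (anyᶠ J ∨ ε))

nbhdπ : Permutation′ n → (I J : Fin n → Bool) → Bool → V n → Bool
nbhdπ π I J ε = extend (on BD (λ m → nbhd₁ id I J m ∨ ε) (λ k → nbhd₂ (flip π) I J k ∨ ε))
                     false ((anyᶠ I ∨ anyᶠ J) ∨ ε) (anyᶠ J ∨ ε)

module Relabelling {n : ℕ} (π₁ π₂ β : Permutation′ n) (β-fixed : ∀ i → isFixed π₂ (β ⟨$⟩ʳ i) ≡ isFixed π₁ i) where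

  τ : Fin n → Permutation′ n
  τ i = twoPointPermutation i (β ⟨$⟩ʳ i) (π₁ ⟨$⟩ʳ i) (π₂ ⟨$⟩ʳ (β ⟨$⟩ʳ i))

  τ-i : ∀ i → τ i ⟨$⟩ʳ i ≡ β ⟨$⟩ʳ i
  τ-i i = twoPointPermutation-p i (β ⟨$⟩ʳ i) (π₁ ⟨$⟩ʳ i) (π₂ ⟨$⟩ʳ (β ⟨$⟩ʳ i))
    (λ i≡π₁i → sym (==⇒≡ (trans (β-fixed i) (≡⇒== (sym i≡π₁i)))))
    (λ βi≡π₂βi → sym (==⇒≡ (trans (sym (β-fixed i)) (≡⇒== (sym βi≡π₂βi)))))

  τ-π₁i : ∀ i → τ i ⟨$⟩ʳ (π₁ ⟨$⟩ʳ i) ≡ π₂ ⟨$⟩ʳ (β ⟨$⟩ʳ i)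
  τ-π₁i i = twoPointPermutation-q i (β ⟨$⟩ʳ i) (π₁ ⟨$⟩ʳ i) (π₂ ⟨$⟩ʳ (β ⟨$⟩ʳ i))

  -- σ ⟨$⟩ʳ m = π₁ ⟨$⟩ˡ (π₂ ⟨$⟩ʳ m)
  σ : Permutation′ n
  σ = π₂ ∘ₚ flip π₁

  Pair : Set
  Pair = (Fin n → Bool) × (Fin n → Bool)

  _≗₂_ : Pair → Pair → Set
  (I , J) ≗₂ (I′ , J′) = I ≗ I′ × J ≗ J′

  -- For I = {i} the second component is J relabelled by τ i, written without extracting i.
  relabel : (I J : Fin n → Bool) → Dec (count I ≡ 1) → Pair
  relabel I J (yes _) = I ∘ (β ⟨$⟩ˡ_) , (λ m → anyᶠ (λ i → I i ∧ J (τ i ⟨$⟩ˡ m)))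
  relabel I J (no _)  = I ∘ (σ ⟨$⟩ʳ_) , J

  unrelabel : (I J : Fin n → Bool) → Dec (count I ≡ 1) → Pair
  unrelabel I J (yes _) = I ∘ (β ⟨$⟩ʳ_) , (λ m → anyᶠ (λ i → I (β ⟨$⟩ʳ i) ∧ J (τ i ⟨$⟩ʳ m)))
  unrelabel I J (no _)  = I ∘ (σ ⟨$⟩ˡ_) , J

  η θ : Pair → Pair
  η (I , J) = relabel I J (count I ℕ.≟ 1)
  θ (I , J) = unrelabel I J (count I ℕ.≟ 1)

  η-cong : ∀ {P P′} → P ≗₂ P′ → η P ≗₂ η P′
  η-cong {I , J} {I′ , J′} (I≗ , J≗) with count I ℕ.≟ 1 | count I′ ℕ.≟ 1
  ... | yes _ | yes _ = (I≗ ∘ (β ⟨$⟩ˡ_)) , (λ m → anyᶠ-cong (λ i → cong₂ _∧_ (I≗ i) (J≗ (τ i ⟨$⟩ˡ m))))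
  ... | no _  | no _  = (I≗ ∘ (σ ⟨$⟩ʳ_)) , J≗
  ... | yes ∣I∣≡1 | no ∣I′∣≢1 = contradiction (trans (sym (count-cong I≗)) ∣I∣≡1) ∣I′∣≢1
  ... | no ∣I∣≢1 | yes ∣I′∣≡1 = contradiction (trans (count-cong I≗) ∣I′∣≡1) ∣I∣≢1

  θ-cong : ∀ {P P′} → P ≗₂ P′ → θ P ≗₂ θ P′
  θ-cong {I , J} {I′ , J′} (I≗ , J≗) with count I ℕ.≟ 1 | count I′ ℕ.≟ 1
  ... | yes _ | yes _ = (I≗ ∘ (β ⟨$⟩ʳ_)) , (λ m → anyᶠ-cong (λ i → cong₂ _∧_ (I≗ (β ⟨$⟩ʳ i)) (J≗ (τ i ⟨$⟩ʳ m))))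
  ... | no _  | no _  = (I≗ ∘ (σ ⟨$⟩ˡ_)) , J≗
  ... | yes ∣I∣≡1 | no ∣I′∣≢1 = contradiction (trans (sym (count-cong I≗)) ∣I∣≡1) ∣I′∣≢1
  ... | no ∣I∣≢1 | yes ∣I′∣≡1 = contradiction (trans (count-cong I≗) ∣I′∣≡1) ∣I∣≢1

  θ∘η : ∀ P → θ (η P) ≗₂ P
  θ∘η (I , J) with count I ℕ.≟ 1
  ... | yes ∣I∣≡1 with count (I ∘ (β ⟨$⟩ˡ_)) ℕ.≟ 1
  ...   | no ∣Iβ⁻¹∣≢1 = contradiction (trans (count-permute I (flip β)) ∣I∣≡1) ∣Iβ⁻¹∣≢1
  ...   | yes _ = (λ m → cong I (inverseˡ β)) , J≗
    where
    i = proj₁ (count≡1⇒singleton I ∣I∣≡1)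
    I≗i = proj₂ (count≡1⇒singleton I ∣I∣≡1)
    J≗ : ∀ m → anyᶠ (λ k → I (β ⟨$⟩ˡ (β ⟨$⟩ʳ k)) ∧ anyᶠ (λ i′ → I i′ ∧ J (τ i′ ⟨$⟩ˡ (τ k ⟨$⟩ʳ m)))) ≡ J m
    J≗ m = begin
      anyᶠ (λ k → I (β ⟨$⟩ˡ (β ⟨$⟩ʳ k)) ∧ anyᶠ (λ i′ → I i′ ∧ J (τ i′ ⟨$⟩ˡ (τ k ⟨$⟩ʳ m))))
        ≡⟨ anyᶠ-cong (λ k → cong₂ _∧_ (cong I (inverseˡ β)) (anyᶠ-∧-singleton I≗i (λ i′ → J (τ i′ ⟨$⟩ˡ (τ k ⟨$⟩ʳ m))))) ⟩
      anyᶠ (λ k → I k ∧ J (τ i ⟨$⟩ˡ (τ k ⟨$⟩ʳ m)))   ≡⟨ anyᶠ-∧-singleton I≗i (λ k → J (τ i ⟨$⟩ˡ (τ k ⟨$⟩ʳ m))) ⟩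
      J (τ i ⟨$⟩ˡ (τ i ⟨$⟩ʳ m))                      ≡⟨ cong J (inverseˡ (τ i)) ⟩
      J m                                            ∎
      where open ≡-Reasoning
  θ∘η (I , J) | no ∣I∣≢1 with count (I ∘ (σ ⟨$⟩ʳ_)) ℕ.≟ 1
  ...   | yes ∣Iσ∣≡1 = contradiction (trans (sym (count-permute I σ)) ∣Iσ∣≡1) ∣I∣≢1
  ...   | no _ = (λ m → cong I (inverseʳ σ)) , (λ m → refl)

  η∘θ : ∀ P → η (θ P) ≗₂ P
  η∘θ (I , J) with count I ℕ.≟ 1
  ... | yes ∣I∣≡1 with count (I ∘ (β ⟨$⟩ʳ_)) ℕ.≟ 1
  ...   | no ∣Iβ∣≢1 = contradiction (trans (count-permute I β) ∣I∣≡1) ∣Iβ∣≢1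
  ...   | yes ∣Iβ∣≡1 = (λ m → cong I (inverseʳ β)) , J≗
    where
    i = proj₁ (count≡1⇒singleton (I ∘ (β ⟨$⟩ʳ_)) ∣Iβ∣≡1)
    Iβ≗i = proj₂ (count≡1⇒singleton (I ∘ (β ⟨$⟩ʳ_)) ∣Iβ∣≡1)
    J≗ : ∀ m → anyᶠ (λ k → I (β ⟨$⟩ʳ k) ∧ anyᶠ (λ i′ → I (β ⟨$⟩ʳ i′) ∧ J (τ i′ ⟨$⟩ʳ (τ k ⟨$⟩ˡ m)))) ≡ J m
    J≗ m = begin
      anyᶠ (λ k → I (β ⟨$⟩ʳ k) ∧ anyᶠ (λ i′ → I (β ⟨$⟩ʳ i′) ∧ J (τ i′ ⟨$⟩ʳ (τ k ⟨$⟩ˡ m))))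
        ≡⟨ anyᶠ-∧-singleton Iβ≗i (λ k → anyᶠ (λ i′ → I (β ⟨$⟩ʳ i′) ∧ J (τ i′ ⟨$⟩ʳ (τ k ⟨$⟩ˡ m)))) ⟩
      anyᶠ (λ i′ → I (β ⟨$⟩ʳ i′) ∧ J (τ i′ ⟨$⟩ʳ (τ i ⟨$⟩ˡ m)))
        ≡⟨ anyᶠ-∧-singleton Iβ≗i (λ i′ → J (τ i′ ⟨$⟩ʳ (τ i ⟨$⟩ˡ m))) ⟩
      J (τ i ⟨$⟩ʳ (τ i ⟨$⟩ˡ m))                      ≡⟨ cong J (inverseʳ (τ i)) ⟩
      J m                                            ∎
      where open ≡-Reasoning
  η∘θ (I , J) | no ∣I∣≢1 with count (I ∘ (σ ⟨$⟩ˡ_)) ℕ.≟ 1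
  ...   | yes ∣Iσ⁻¹∣≡1 = contradiction (trans (sym (count-permute I (flip σ))) ∣Iσ⁻¹∣≡1) ∣I∣≢1
  ...   | no _ = (λ m → cong I (inverseˡ σ)) , (λ m → refl)

  module Singleton {I : Fin n → Bool} {i : Fin n} (I≗i : I ≗ (_== i)) (J : Fin n → Bool) where

    I′ J′ : Fin n → Bool
    I′ = I ∘ (β ⟨$⟩ˡ_)
    J′ = J ∘ (τ i ⟨$⟩ˡ_)

    I′≗βi : I′ ≗ (_== (β ⟨$⟩ʳ i))
    I′≗βi k = trans (I≗i (β ⟨$⟩ˡ k)) (⟨$⟩ˡ-== β k i)

    relabel-J : (λ m → anyᶠ (λ k → I k ∧ J (τ k ⟨$⟩ˡ m))) ≗ J′
    relabel-J m = anyᶠ-∧-singleton I≗i (λ k → J (τ k ⟨$⟩ˡ m))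

    nbhd₁-relabel : ∀ m → nbhd₁ id I′ J′ (τ i ⟨$⟩ʳ m) ≡ nbhd₁ id I J m
    nbhd₁-relabel m = cong₂ _∨_ (begin
      anyᶠ (I′ ─ (τ i ⟨$⟩ʳ m))             ≡⟨ anyᶠ-─-singleton I′≗βi (τ i ⟨$⟩ʳ m) ⟩
      not ((β ⟨$⟩ʳ i) == (τ i ⟨$⟩ʳ m))     ≡⟨ cong (λ k → not (k == (τ i ⟨$⟩ʳ m))) (τ-i i) ⟨
      not ((τ i ⟨$⟩ʳ i) == (τ i ⟨$⟩ʳ m))   ≡⟨ cong not (==-⟨$⟩ʳ (τ i) i m) ⟩
      not (i == m)                         ≡⟨ anyᶠ-─-singleton I≗i m ⟨
      anyᶠ (I ─ m)                         ∎)
      (cong J (inverseˡ (τ i)))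
      where open ≡-Reasoning

    nbhd₂-relabel : ∀ k → nbhd₂ (flip π₂) I′ J′ (τ i ⟨$⟩ʳ k) ≡ nbhd₂ (flip π₁) I J k
    nbhd₂-relabel k = cong₂ _∨_ (begin
      I′ (π₂ ⟨$⟩ˡ (τ i ⟨$⟩ʳ k))                   ≡⟨ I′≗βi (π₂ ⟨$⟩ˡ (τ i ⟨$⟩ʳ k)) ⟩
      ((π₂ ⟨$⟩ˡ (τ i ⟨$⟩ʳ k)) == (β ⟨$⟩ʳ i))      ≡⟨ ⟨$⟩ˡ-== π₂ (τ i ⟨$⟩ʳ k) (β ⟨$⟩ʳ i) ⟩
      ((τ i ⟨$⟩ʳ k) == (π₂ ⟨$⟩ʳ (β ⟨$⟩ʳ i)))      ≡⟨ cong ((τ i ⟨$⟩ʳ k) ==_) (τ-π₁i i) ⟨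
      ((τ i ⟨$⟩ʳ k) == (τ i ⟨$⟩ʳ (π₁ ⟨$⟩ʳ i)))    ≡⟨ ==-⟨$⟩ʳ (τ i) k (π₁ ⟨$⟩ʳ i) ⟩
      (k == (π₁ ⟨$⟩ʳ i))                          ≡⟨ ⟨$⟩ˡ-== π₁ k i ⟨
      ((π₁ ⟨$⟩ˡ k) == i)                          ≡⟨ I≗i (π₁ ⟨$⟩ˡ k) ⟨
      I (π₁ ⟨$⟩ˡ k)                               ∎)
      (trans (sym (anyᶠ-permute (J′ ─ (τ i ⟨$⟩ʳ k)) (τ i)))
        (anyᶠ-cong (λ j → cong₂ _∧_ (cong J (inverseˡ (τ i))) (cong not (==-⟨$⟩ʳ (τ i) j k)))))
      where open ≡-Reasoning

  nbhdSizeπ-cong : ∀ {I J I′ J′ : Fin n → Bool} ε →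
    count (nbhd₁ id I′ J′) ≡ count (nbhd₁ id I J) → count (nbhd₂ (flip π₂) I′ J′) ≡ count (nbhd₂ (flip π₁) I J) →
    anyᶠ I′ ≡ anyᶠ I → anyᶠ J′ ≡ anyᶠ J → nbhdSizeπ π₂ I′ J′ ε ≡ nbhdSizeπ π₁ I J ε
  nbhdSizeπ-cong {I} {J} {I′} {J′} ε ∣N₁∣≡ ∣N₂∣≡ anyI≡ anyJ≡ =
    cong₂ _+_ (cong₂ _+_ (count-∨ʳ {P = nbhd₁ id I′ J′} ∣N₁∣≡ ε) (count-∨ʳ {P = nbhd₂ (flip π₂) I′ J′} ∣N₂∣≡ ε))
              (cong₂ _+_ (cong (λ x → 𝟙 (x ∨ ε)) (cong₂ _∨_ anyI≡ anyJ≡)) (cong (λ x → 𝟙 (x ∨ ε)) anyJ≡))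

  η-sizes : ∀ I J ε → let (I′ , J′) = η (I , J) in
            count I′ + count J′ + 𝟙 ε ≡ count I + count J + 𝟙 ε × nbhdSizeπ π₂ I′ J′ ε ≡ nbhdSizeπ π₁ I J ε
  η-sizes I J ε with count I ℕ.≟ 1
  ... | yes ∣I∣≡1 = cong (_+ 𝟙 ε) (cong₂ _+_ (count-permute I (flip β)) ∣Jη∣≡∣J∣) ,
                    nbhdSizeπ-cong ε ∣N₁∣≡ ∣N₂∣≡ (anyᶠ-permute I (flip β))
                      (trans (anyᶠ-cong relabel-J) (anyᶠ-permute J (flip (τ i))))
    where
    i = proj₁ (count≡1⇒singleton I ∣I∣≡1)
    open Singleton (proj₂ (count≡1⇒singleton I ∣I∣≡1)) J
    Jη = proj₂ (relabel I J (yes ∣I∣≡1))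
    ∣Jη∣≡∣J∣ : count Jη ≡ count J
    ∣Jη∣≡∣J∣ = trans (count-cong relabel-J) (count-permute J (flip (τ i)))
    ∣N₁∣≡ : count (nbhd₁ id I′ Jη) ≡ count (nbhd₁ id I J)
    ∣N₁∣≡ = begin
      count (nbhd₁ id I′ Jη)                    ≡⟨ count-cong (nbhd₁-cong id {P = I′} (λ _ → refl) relabel-J) ⟩
      count (nbhd₁ id I′ J′)                    ≡⟨ count-permute (nbhd₁ id I′ J′) (τ i) ⟨
      count (nbhd₁ id I′ J′ ∘ (τ i ⟨$⟩ʳ_))      ≡⟨ count-cong nbhd₁-relabel ⟩
      count (nbhd₁ id I J)                      ∎
      where open ≡-Reasoning
    ∣N₂∣≡ : count (nbhd₂ (flip π₂) I′ Jη) ≡ count (nbhd₂ (flip π₁) I J)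
    ∣N₂∣≡ = begin
      count (nbhd₂ (flip π₂) I′ Jη)                  ≡⟨ count-cong (nbhd₂-cong (flip π₂) {P = I′} (λ _ → refl) relabel-J) ⟩
      count (nbhd₂ (flip π₂) I′ J′)                  ≡⟨ count-permute (nbhd₂ (flip π₂) I′ J′) (τ i) ⟨
      count (nbhd₂ (flip π₂) I′ J′ ∘ (τ i ⟨$⟩ʳ_))    ≡⟨ count-cong nbhd₂-relabel ⟩
      count (nbhd₂ (flip π₁) I J)                    ∎
      where open ≡-Reasoning
  ... | no ∣I∣≢1 = cong (_+ 𝟙 ε) (cong (_+ count J) (count-permute I σ)) ,
                   nbhdSizeπ-cong ε
                     (count-cong (λ m → cong (_∨ J m) (anyᶠ-─-count≢1 I (I ∘ (σ ⟨$⟩ʳ_)) ∣I∣≢1 (count-permute I σ) m)))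
                     (count-cong (λ k → cong (λ x → I (π₁ ⟨$⟩ˡ x) ∨ anyᶠ (J ─ k)) (inverseʳ π₂)))
                     (anyᶠ-permute I σ) refl

module _ {n : ℕ} where

  module E = Enumeration (decode n) encode decode-encode (encode-decode {n})

  Xπ : Subset (4 * n + 3)
  Xπ = E.fromχ inXπ

  Xπ-bipartition : (π : Permutation′ n) → IsBipartition (Gπ π) Xπ
  Xπ-bipartition π = E.fromχ-bipartition (adjV π) inXπ adjV-crosses-Xπ

  Gπ-connected : (π : Permutation′ n) → Connected (Gπ π)
  Gπ-connected π = E.connected-via (adjV π) e to-e from-e
    where
    edge : ∀ x y → adjV π x y ≡ true → Reach (Gπ π) (encode x) (encode y)
    edge x y xy = step (E.adj-encode (adjV π) {x} {y} xy) here
    to-e : ∀ x → Reach (Gπ π) (encode x) (encode {n} e)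
    to-e (old (a i)) = Reach-trans (edge (old (a i)) f refl) (edge f e refl)
    to-e (old (b i)) = edge (old (b i)) e refl
    to-e (old (c i)) = Reach-trans (edge (old (c i)) f refl) (edge f e refl)
    to-e (old (d i)) = edge (old (d i)) e refl
    to-e e           = here
    to-e f           = edge f e refl
    to-e g           = edge g e refl
    from-e : ∀ x → Reach (Gπ π) (encode {n} e) (encode x)
    from-e (old (a i)) = Reach-trans (edge e f refl) (edge f (old (a i)) refl)
    from-e (old (b i)) = edge e (old (b i)) refl
    from-e (old (c i)) = Reach-trans (edge e f refl) (edge f (old (c i)) refl)
    from-e (old (d i)) = edge e (old (d i)) refl
    from-e e           = here
    from-e f           = edge e f refl
    from-e g           = edge e g refl

  ∣∣≡countV : (S : Subset (4 * n + 3)) → ∣ S ∣ ≡ countV (E.χ S)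
  ∣∣≡countV S = trans (E.∣∣≡count S) (count-decode (E.χ S))

  ∣Xπ∣ : ∣ Xπ ∣ ≡ (n + n) + 1
  ∣Xπ∣ = trans (∣∣≡countV Xπ) (trans (countV-cong (E.χ-fromχ inXπ))
    (cong (_+ 1) (trans (count⁻-on {n} AC (λ _ → true) (λ _ → true)) (cong₂ _+_ (count-true {n}) (count-true {n})))))

  ∣∁Xπ∣ : ∣ ∁ Xπ ∣ ≡ (n + n) + 2
  ∣∁Xπ∣ = trans (∣∣≡countV (∁ Xπ))
    (trans (countV-cong (λ v → trans (E.χ-∁ Xπ v) (trans (cong not (E.χ-fromχ inXπ v)) (not-inXπ v))))
    (cong (_+ 2) (trans (count⁻-on {n} BD (λ _ → true) (λ _ → true)) (cong₂ _+_ (count-true {n}) (count-true {n})))))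

  ⊆Xπ⇒extend : {S : Subset (4 * n + 3)} → S ⊆ Xπ →
                E.χ S ≗ extend (on AC (E.χ S ∘ old ∘ a) (E.χ S ∘ old ∘ c)) (E.χ S e) false false
  ⊆Xπ⇒extend S⊆X (old (a m)) = refl
  ⊆Xπ⇒extend S⊆X (old (b m)) = E.⊆-χ-false S⊆X (old (b m)) (E.χ-fromχ inXπ (old (b m)))
  ⊆Xπ⇒extend S⊆X (old (c m)) = refl
  ⊆Xπ⇒extend S⊆X (old (d m)) = E.⊆-χ-false S⊆X (old (d m)) (E.χ-fromχ inXπ (old (d m)))
  ⊆Xπ⇒extend S⊆X e           = refl
  ⊆Xπ⇒extend S⊆X f           = E.⊆-χ-false S⊆X f (E.χ-fromχ inXπ f)
  ⊆Xπ⇒extend S⊆X g           = E.⊆-χ-false S⊆X g (E.χ-fromχ inXπ g)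

  χ-Nbhdπ : (π : Permutation′ n) {S : Subset (4 * n + 3)} {I J : Fin n → Bool} {ε : Bool} →
            E.χ S ≗ extend (on AC I J) ε false false → E.χ (Nbhd (Gπ π) S) ≗ nbhdπ π I J ε
  χ-Nbhdπ π {S} {I} {J} {ε} S≗ v = begin
    E.χ (Nbhd (Gπ π) S) v                                           ≡⟨ E.χ-Nbhd (adjV π) S v ⟩
    anyᶠ (λ k → E.χ S (decode n k) ∧ adjV π (decode n k) v)         ≡⟨ anyᶠ-decode (λ w → E.χ S w ∧ adjV π w v) ⟩
    anyV (λ w → E.χ S w ∧ adjV π w v)                               ≡⟨ anyV-cong (λ w → cong (_∧ adjV π w v) (S≗ w)) ⟩
    anyV (λ w → extend (on AC I J) ε false false w ∧ adjV π w v)    ≡⟨ by-cases v ⟩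
    nbhdπ π I J ε v                                                   ∎
    where
    open ≡-Reasoning
    old-cases : ∀ y → on BD (nbhd₁ id I J) (nbhd₂ (flip π) I J) y ∨ ((ε ∧ adjV π e (old y)) ∨ false) ≡ nbhdπ π I J ε (old y)
    old-cases (a m) rewrite ∧-zeroʳ ε = refl
    old-cases (b m) = cong (nbhd₁ id I J m ∨_) (trans (∨-identityʳ _) (∧-identityʳ ε))
    old-cases (c m) rewrite ∧-zeroʳ ε = refl
    old-cases (d k) = cong (nbhd₂ (flip π) I J k ∨_) (trans (∨-identityʳ _) (∧-identityʳ ε))
    by-cases : ∀ v → anyV (λ w → extend (on AC I J) ε false false w ∧ adjV π w v) ≡ nbhdπ π I J ε v
    by-cases (old y) = trans (cong (_∨ ((ε ∧ adjV π e (old y)) ∨ false)) (nbhd⁻-on π AC I J y)) (old-cases y)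
    by-cases e rewrite anyV⁻-on AC I J (λ x → adjV π (old x) e) | anyᶠ-∧-false I | anyᶠ-∧-false J | ∧-zeroʳ ε = refl
    by-cases f rewrite anyV⁻-on AC I J (λ x → adjV π (old x) f) | anyᶠ-∧-true I | anyᶠ-∧-true J
                     | ∧-identityʳ ε | ∨-identityʳ ε = refl
    by-cases g rewrite anyV⁻-on AC I J (λ x → adjV π (old x) g) | anyᶠ-∧-false I | anyᶠ-∧-true J
                     | ∧-identityʳ ε | ∨-identityʳ ε = refl

  extend-sizes : (π : Permutation′ n) {S : Subset (4 * n + 3)} {I J : Fin n → Bool} {ε : Bool} →
                 E.χ S ≗ extend (on AC I J) ε false false →
                 ∣ S ∣ ≡ count I + count J + 𝟙 ε × ∣ Nbhd (Gπ π) S ∣ ≡ nbhdSizeπ π I J ε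
  extend-sizes π {S} {I} {J} {ε} S≗ =
    trans (∣∣≡countV S) (trans (countV-cong S≗) (cong₂ _+_ (count⁻-on AC I J) (+-identityʳ (𝟙 ε)))) ,
    trans (∣∣≡countV (Nbhd (Gπ π) S)) (trans (countV-cong (χ-Nbhdπ π {S} S≗))
      (cong₂ _+_ (count⁻-on BD (λ m → nbhd₁ id I J m ∨ ε) (λ k → nbhd₂ (flip π) I J k ∨ ε)) (cong (𝟙 ((anyᶠ I ∨ anyᶠ J) ∨ ε) +_) (+-identityʳ (𝟙 (anyᶠ J ∨ ε))))))

  assemble : (I J : Fin n → Bool) → Bool → Subset (4 * n + 3)
  assemble I J ε = E.fromχ (extend (on AC I J) ε false false)

  assemble-χ : (I J : Fin n → Bool) (ε : Bool) → E.χ (assemble I J ε) ≗ extend (on AC I J) ε false false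
  assemble-χ I J ε = E.χ-fromχ (extend (on AC I J) ε false false)

  assemble⊆Xπ : (I J : Fin n → Bool) (ε : Bool) → assemble I J ε ⊆ Xπ
  assemble⊆Xπ I J ε = E.χ⇒⊆ (λ v v∈ → trans (E.χ-fromχ inXπ v) (extend⇒inXπ v (trans (sym (assemble-χ I J ε v)) v∈)))
    where
    extend⇒inXπ : ∀ v → extend (on AC I J) ε false false v ≡ true → inXπ v ≡ true
    extend⇒inXπ (old x) = on⇒side AC x
    extend⇒inXπ e _     = refl

  assemble-cong : {I I′ J J′ : Fin n → Bool} {ε ε′ : Bool} → I ≗ I′ → J ≗ J′ → ε ≡ ε′ → assemble I J ε ≡ assemble I′ J′ ε′
  assemble-cong I≗ J≗ refl = E.fromχ-cong (extend-cong (on-cong AC I≗ J≗))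

  ⊆Xπ⇒assemble : {S : Subset (4 * n + 3)} → S ⊆ Xπ → assemble (E.χ S ∘ old ∘ a) (E.χ S ∘ old ∘ c) (E.χ S e) ≡ S
  ⊆Xπ⇒assemble {S} S⊆X = E.χ-injective (λ v → trans (assemble-χ _ _ _ v) (sym (⊆Xπ⇒extend S⊆X v)))

  Gπ≈Gπ : (π₁ π₂ β : Permutation′ n) → (∀ i → isFixed π₂ (β ⟨$⟩ʳ i) ≡ isFixed π₁ i) → Gπ π₁ ≈ Gπ π₂
  Gπ≈Gπ π₁ π₂ β β-fixed =
    Gπ-connected π₁ , Gπ-connected π₂ , Xπ , Xπ , Xπ-bipartition π₁ , Xπ-bipartition π₂ , ∣X∣≤∣∁X∣ , ∣X∣≤∣∁X∣ ,
    refl , refl , lift η , (λ S _ → assemble⊆Xπ _ _ _) ,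
    (λ S S′ S⊆ S′⊆ eq → trans (sym (lift-inverse η θ θ-cong θ∘η S S⊆))
                          (trans (cong (lift θ) eq) (lift-inverse η θ θ-cong θ∘η S′ S′⊆))) ,
    (λ T T⊆ → lift θ T , assemble⊆Xπ _ _ _ , lift-inverse θ η η-cong η∘θ T T⊆) ,
    lift-η-sizes
    where
    open Relabelling π₁ π₂ β β-fixed

    ∣X∣≤∣∁X∣ : ∣ Xπ ∣ ≤ ∣ ∁ Xπ ∣
    ∣X∣≤∣∁X∣ = subst₂ _≤_ (sym ∣Xπ∣) (sym ∣∁Xπ∣) (+-monoʳ-≤ (n + n) (s≤s z≤n))

    parts : Subset (4 * n + 3) → Pair
    parts S = E.χ S ∘ old ∘ a , E.χ S ∘ old ∘ c

    lift : (Pair → Pair) → Subset (4 * n + 3) → Subset (4 * n + 3)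
    lift F S = assemble (proj₁ (F (parts S))) (proj₂ (F (parts S))) (E.χ S e)

    lift-inverse : (F G : Pair → Pair) → (∀ {P P′} → P ≗₂ P′ → G P ≗₂ G P′) → (∀ P → G (F P) ≗₂ P) →
                   ∀ S → S ⊆ Xπ → lift G (lift F S) ≡ S
    lift-inverse F G G-cong G∘F S S⊆X = begin
      lift G (lift F S)                                      ≡⟨ assemble-cong (proj₁ G-parts) (proj₂ G-parts) (assemble-χ _ _ _ e) ⟩
      assemble (proj₁ (G (F (parts S)))) (proj₂ (G (F (parts S)))) (E.χ S e)
                                                             ≡⟨ assemble-cong (proj₁ (G∘F (parts S))) (proj₂ (G∘F (parts S))) refl ⟩
      assemble (E.χ S ∘ old ∘ a) (E.χ S ∘ old ∘ c) (E.χ S e) ≡⟨ ⊆Xπ⇒assemble S⊆X ⟩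
      S                                                      ∎
      where
      open ≡-Reasoning
      G-parts : G (parts (lift F S)) ≗₂ G (F (parts S))
      G-parts = G-cong ((assemble-χ _ _ _ ∘ old ∘ a) , (assemble-χ _ _ _ ∘ old ∘ c))

    lift-η-sizes : ∀ S → S ⊆ Xπ → ∣ lift η S ∣ ≡ ∣ S ∣ × ∣ Nbhd (Gπ π₂) (lift η S) ∣ ≡ ∣ Nbhd (Gπ π₁) S ∣
    lift-η-sizes S S⊆X =
      trans (proj₁ image) (trans (proj₁ invariant) (sym (proj₁ original))) ,
      trans (proj₂ image) (trans (proj₂ invariant) (sym (proj₂ original)))
      where
      I J I′ J′ : Fin n → Bool
      I  = E.χ S ∘ old ∘ a
      J  = E.χ S ∘ old ∘ c
      I′ = proj₁ (η (I , J))
      J′ = proj₂ (η (I , J))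
      ε  = E.χ S e
      original : ∣ S ∣ ≡ count I + count J + 𝟙 ε × ∣ Nbhd (Gπ π₁) S ∣ ≡ nbhdSizeπ π₁ I J ε
      original = extend-sizes π₁ {S} (⊆Xπ⇒extend S⊆X)
      image : ∣ lift η S ∣ ≡ count I′ + count J′ + 𝟙 ε × ∣ Nbhd (Gπ π₂) (lift η S) ∣ ≡ nbhdSizeπ π₂ I′ J′ ε
      image = extend-sizes π₂ {lift η S} (assemble-χ I′ J′ ε)
      invariant : count I′ + count J′ + 𝟙 ε ≡ count I + count J + 𝟙 ε × nbhdSizeπ π₂ I′ J′ ε ≡ nbhdSizeπ π₁ I J ε
      invariant = η-sizes I J ε

lemma18 : (n : ℕ) → 3 ≤ n → (π₁ π₂ : Permutation′ n) →
    G⁻ π₁ ≈ G⁻ π₂ → Gπ π₁ ≈ Gπ π₂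
lemma18 n 3≤n π₁ π₂ G⁻≈ = Gπ≈Gπ π₁ π₂ (proj₁ β) (proj₂ β)
  where
  β : Σ (Permutation′ n) λ β → isFixed π₂ ∘ (β ⟨$⟩ʳ_) ≗ isFixed π₁
  β = count≡⇒permutation (isFixed π₁) (isFixed π₂) (≈⇒fixedPoints≡ 3≤n π₁ π₂ G⁻≈)
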